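{- Let $p^{(3)}(n)$ be defined by $\sum_{n\ge0}p^{(3)}(n)q^n=\prod_{j\ge1}(1-q^j)^{ -3}$ (the number of three-colored partitions of $n$). Let $P_3=\{j(j+1)/2: j\in\mathbb N\}$ be the positive triangular numbers. For a composition $c$ with parts in $P_3$, let $m_i=m_i(c)$ denote the number of parts equal to $i$, and let $\ell^+(c)$ be the number of parts of $c$ lying in $\{n(2n+1): n\in\mathbb N\}$. Then for every $n\ge 0$, \[ p^{(3)}(n)=\sum_{\substack{c\in\mathcal C_{P_3}\\ |c|=n}}(-1)^{\ell^+(c)}\prod_{j\ge1}(2j+1)^{m_{j(j+1)/2}(c)}. \]
   Context: A composition is an ordered finite sequence of positive integers (its parts), the empty composition included; $|c|$ is the sum of the parts; $\mathcal C_{S}$ is the set of compositions all of whose parts lie in $S$. Parts are counted with multiplicity in $\ell^+(c)$. -}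

module Defs where

open import Data.Nat using (ℕ; zero; suc; _+_; _*_; _∸_; _^_; _≡ᵇ_)
open import Data.Nat.DivMod using (_%_)
open import Data.Bool using (Bool; true; false; if_then_else_)
open import Data.List using (List; []; _∷_; map; upTo; foldr)
open import Data.Bool.ListAction using (any)
open import Data.Nat.ListAction using (sum)
open import Data.Integer as ℤ using (ℤ; +_; -[1+_])
open import Data.Product using (∃-syntax)
open import Relation.Binary.PropositionalEquality using (_≡_)
open import Relation.Nullary.Decidable using (Dec)
open import Data.Nat using (_≟_)

Series : Set
Series = ℕ → ℕ

Σ≤ : ℕ → (ℕ → ℕ) → ℕ
Σ≤ zero    f = f 0
Σ≤ (suc n) f = Σ≤ n f + f (suc n)

_⊛_ : Series → Series → Series
(f ⊛ g) n = Σ≤ n (λ i → f i * g (n ∸ i))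

one : Series
one zero    = 1
one (suc _) = 0

-- (1 - q^(k+1))^{-1} = Σ_m q^{(k+1) m}
geomInv : ℕ → Series
geomInv k n = if (n % suc k) ≡ᵇ 0 then 1 else 0

prodInv3 : ℕ → Series
prodInv3 zero    = one
prodInv3 (suc N) = prodInv3 N ⊛ (geomInv N ⊛ (geomInv N ⊛ geomInv N))

-- p^(3)(n) : coefficient of q^n in ∏_{j≥1}(1-q^j)^{-3}.
-- Factors with j > n do not affect the coefficient of q^n, so the
-- truncation at N = n gives the coefficient of the infinite product.
p3 : ℕ → ℕ
p3 n = prodInv3 n n

tri : ℕ → ℕ
tri zero    = 0
tri (suc j) = suc j + tri j

InP3 : ℕ → Set
InP3 x = ∃[ k ] x ≡ tri (suc k)

-- x ∈ { m(2m+1) : m ∈ ℕ }, decided by bounded search (m ≤ x suffices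
-- since m ≤ m(2m+1) for all m).
isHex : ℕ → Bool
isHex x = any (λ m → x ≡ᵇ (m * (2 * m + 1))) (upTo (suc x))

ℓ⁺ : List ℕ → ℕ
ℓ⁺ []      = 0
ℓ⁺ (x ∷ c) = (if isHex x then 1 else 0) + ℓ⁺ c

mult : ℕ → List ℕ → ℕ
mult i []      = 0
mult i (x ∷ c) = (if i ≡ᵇ x then 1 else 0) + mult i c

prodUpTo : ℕ → List ℕ → ℕ
prodUpTo zero    c = 1
prodUpTo (suc N) c = prodUpTo N c * ((2 * suc N + 1) ^ mult (tri (suc N)) c)

-- ∏_{j≥1} (2j+1)^{m_{j(j+1)/2}(c)}; factors with j > |c| have
-- exponent 0 because tri j > |c| ≥ every part.
weightProd : List ℕ → ℕ
weightProd c = prodUpTo (sum c) c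

weight : List ℕ → ℤ
weight c = (ℤ.- (+ 1)) ℤ.^ ℓ⁺ c ℤ.* + weightProd c

sumℤ : List ℤ → ℤ
sumℤ = foldr ℤ._+_ (+ 0)

-- Multiplying the generating function of p⁽³⁾ by ∏ⱼ (1 - qʲ)³ and using Jacobi's identity
-- ∏ⱼ (1 - qʲ)³ = Σₖ (-1)ᵏ (2k + 1) q^(k(k+1)/2) gives, for n ≥ 1, the recurrence
-- p⁽³⁾(n) = Σ_{k ≥ 1} (-1)^(k+1) (2k + 1) p⁽³⁾(n - k(k+1)/2). Splitting off the first part
-- k(k+1)/2 of a composition shows that the weighted sum over compositions obeys the same
-- recurrence: that part contributes (-1)^(k+1) (2k + 1), because k(k+1)/2 = m(2m + 1) exactly
-- when k = 2m.
--
-- Jacobi's identity is proved modulo q^(n+1) from a finite form. With T(k) = k(k+1)/2, the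
-- polynomial Pₙ(z) = (z - 1) ∏ⱼ₌₁ⁿ (z - qʲ)(1 - qʲ z) has coefficients
-- (-1)^(n+1+i) q^T(i-n-1) [2n+1, i], by induction on n through the q-Pascal rules. Hence
-- Pₙ(1) = 0 and Pₙ′(1) = (q; q)ₙ². Since (q; q)ₙ [2n+1, i] ≡ 1 modulo q^(min(i, 2n+1-i)+1),
-- which the factor q^T(i-n-1) raises to q^(n+1), multiplying Pₙ′(1) by (q; q)ₙ gives
-- (q; q)ₙ³ ≡ Σᵢ i (-1)^(n+1+i) q^T(i-n-1), where the terms i = n - k and i = n + 1 + k
-- combine to (-1)ᵏ (2k + 1) q^T(k).

module Submission where

open import Defs
open import Data.Nat as ℕ using (ℕ; zero; suc; _≤_; _<_; z≤n; s≤s; _∸_; _≤ᵇ_; _≡ᵇ_; _^_)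
import Data.Nat.Properties as ℕₚ
import Data.Nat.Tactic.RingSolver as ℕ-Solver
open import Data.Nat.DivMod using (_%_; [m+n]%n≡m%n; m<n⇒m%n≡m)
open import Data.Nat.ListAction using (sum)
open import Data.Integer using (ℤ; +_; -[1+_]; 0ℤ; 1ℤ; _+_; _*_; -_; _-_) renaming (_^_ to _^ℤ_)
import Data.Integer.Properties as ℤₚ
open import Data.Integer.Tactic.RingSolver using (solve-∀)
open import Data.Bool using (Bool; true; false; if_then_else_; T)
open import Data.Empty using (⊥-elim)
open import Data.List using (List; []; _∷_; upTo; applyUpTo; map; _++_)
open import Data.List.Properties using (∷-injectiveˡ; ∷-injectiveʳ)
open import Data.List.Membership.Propositional using (_∈_; lose; find)
open import Data.List.Membership.Propositional.Properties
  using (∈-++⁻; ∈-++⁺ˡ; ∈-++⁺ʳ; ∈-map⁻; ∈-map⁺; ∈-upTo⁺)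
open import Data.List.Membership.Propositional.Properties.WithK using (unique∧set⇒bag)
open import Data.List.Relation.Unary.Any using (here; there)
open import Data.List.Relation.Unary.Any.Properties using (any⁺; any⁻)
open import Data.List.Relation.Unary.All as All using (All; []; _∷_)
open import Data.List.Relation.Unary.AllPairs using ([]; _∷_)
open import Data.List.Relation.Unary.Unique.Propositional using (Unique)
import Data.List.Relation.Unary.Unique.Propositional.Properties as Unique
open import Data.List.Relation.Binary.Disjoint.Propositional using (Disjoint)
open import Data.List.Relation.Binary.BagAndSetEquality using (∼bag⇒↭)
open import Data.List.Relation.Binary.Permutation.Propositional using (_↭_; ↭-sym; ↭⇒↭ₛ′)
import Data.List.Relation.Binary.Permutation.Propositional.Properties as Perm
import Data.List.Relation.Binary.Permutation.Setoid.Properties as PermSetoid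
open import Data.Product using (_×_; ∃-syntax; _,_)
open import Data.Sum using (_⊎_; inj₁; inj₂)
open import Algebra.Bundles using (CommutativeMonoid)
open import Function using (_∘_; id)
open import Function.Bundles using (_⇔_; mk⇔; Equivalence)
open import Relation.Nullary using (¬_)
open import Relation.Binary.Definitions using (tri<; tri≈; tri>)
open import Relation.Binary.PropositionalEquality

infix 8 ∑
∑ : ℕ → (ℕ → ℤ) → ℤ
∑ zero    f = 0ℤ
∑ (suc n) f = f 0 + ∑ n (f ∘ suc)

syntax ∑ n (λ i → e) = ∑[ i < n ] e

∑-cong : ∀ n {f g} → (∀ i → i < n → f i ≡ g i) → ∑ n f ≡ ∑ n g
∑-cong zero    eq = refl
∑-cong (suc n) eq = cong₂ _+_ (eq 0 (s≤s z≤n)) (∑-cong n (λ i i<n → eq (suc i) (s≤s i<n)))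

∑-zero : ∀ n → ∑[ _ < n ] 0ℤ ≡ 0ℤ
∑-zero zero    = refl
∑-zero (suc n) = trans (ℤₚ.+-identityˡ _) (∑-zero n)

∑-distrib-+ : ∀ n f g → ∑[ i < n ] (f i + g i) ≡ ∑ n f + ∑ n g
∑-distrib-+ zero    f g = refl
∑-distrib-+ (suc n) f g =
  trans (cong (λ z → (f 0 + g 0) + z) (∑-distrib-+ n (f ∘ suc) (g ∘ suc))) (interchange (f 0) (g 0) _ _)
  where
  interchange : ∀ a b c d → (a + b) + (c + d) ≡ (a + c) + (b + d)
  interchange = solve-∀

∑-neg : ∀ n f → ∑[ i < n ] (- f i) ≡ - ∑ n f
∑-neg zero    f = refl
∑-neg (suc n) f =
  trans (cong (λ z → - f 0 + z) (∑-neg n (f ∘ suc))) (sym (ℤₚ.neg-distrib-+ (f 0) _))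

∑-split : ∀ m n f → ∑ (m ℕ.+ n) f ≡ ∑ m f + ∑[ i < n ] f (m ℕ.+ i)
∑-split zero    n f = sym (ℤₚ.+-identityˡ _)
∑-split (suc m) n f =
  trans (cong (λ z → f 0 + z) (∑-split m n (f ∘ suc))) (sym (ℤₚ.+-assoc (f 0) _ _))

∑-last : ∀ n f → ∑ (suc n) f ≡ ∑ n f + f n
∑-last n f = begin
  ∑ (suc n) f                     ≡⟨ cong (λ k → ∑ k f) (ℕₚ.+-comm 1 n) ⟩
  ∑ (n ℕ.+ 1) f                   ≡⟨ ∑-split n 1 f ⟩
  ∑ n f + (f (n ℕ.+ 0) + 0ℤ)      ≡⟨ cong (λ z → ∑ n f + z) (ℤₚ.+-identityʳ _) ⟩
  ∑ n f + f (n ℕ.+ 0)             ≡⟨ cong (λ k → ∑ n f + f k) (ℕₚ.+-identityʳ n) ⟩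
  ∑ n f + f n                     ∎
  where open ≡-Reasoning

∑-reverse : ∀ n f → ∑ n f ≡ ∑[ i < n ] f (n ∸ suc i)
∑-reverse zero    f = refl
∑-reverse (suc n) f = begin
  ∑ (suc n) f                          ≡⟨ ∑-last n f ⟩
  ∑ n f + f n                          ≡⟨ cong (_+ f n) (∑-reverse n f) ⟩
  ∑[ i < n ] f (n ∸ suc i) + f n       ≡⟨ ℤₚ.+-comm _ (f n) ⟩
  ∑[ i < suc n ] f (suc n ∸ suc i)     ∎
  where open ≡-Reasoning

∑-vanishing : ∀ m n f → m ≤ n → (∀ i → m ≤ i → f i ≡ 0ℤ) → ∑ n f ≡ ∑ m f
∑-vanishing m n f m≤n zero-from-m = begin
  ∑ n f                                   ≡⟨ cong (λ k → ∑ k f) (sym (ℕₚ.m+[n∸m]≡n m≤n)) ⟩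
  ∑ (m ℕ.+ (n ∸ m)) f                     ≡⟨ ∑-split m (n ∸ m) f ⟩
  ∑ m f + ∑[ i < n ∸ m ] f (m ℕ.+ i)      ≡⟨ cong (λ z → ∑ m f + z) tail-zero ⟩
  ∑ m f + 0ℤ                              ≡⟨ ℤₚ.+-identityʳ _ ⟩
  ∑ m f                                   ∎
  where
  open ≡-Reasoning
  tail-zero : ∑[ i < n ∸ m ] f (m ℕ.+ i) ≡ 0ℤ
  tail-zero = trans (∑-cong (n ∸ m) (λ i _ → zero-from-m (m ℕ.+ i) (ℕₚ.m≤m+n m i))) (∑-zero (n ∸ m))

-- Formal power series with integer coefficients

ℤSeries : Set
ℤSeries = ℕ → ℤ

0ˢ : ℤSeries
0ˢ _ = 0ℤ

1ˢ : ℤSeries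
1ˢ zero    = 1ℤ
1ˢ (suc _) = 0ℤ

infixl 6 _⊕_
_⊕_ : ℤSeries → ℤSeries → ℤSeries
(f ⊕ g) n = f n + g n

infix 8 ⊖_
⊖_ : ℤSeries → ℤSeries
(⊖ f) n = - f n

infixr 7 _•_
_•_ : ℤ → ℤSeries → ℤSeries
(c • f) n = c * f n

∑ˢ : ℕ → (ℕ → ℤSeries) → ℤSeries
∑ˢ m F n = ∑[ i < m ] F i n

tail : ℤSeries → ℤSeries
tail f n = f (suc n)

infixl 7 _⊗_
_⊗_ : ℤSeries → ℤSeries → ℤSeries
(f ⊗ g) zero    = f 0 * g 0
(f ⊗ g) (suc n) = f 0 * g (suc n) + (tail f ⊗ g) n

shift₁ : ℤSeries → ℤSeries
shift₁ f zero    = 0ℤ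
shift₁ f (suc n) = f n

infixr 7 q^_·_
q^_·_ : ℕ → ℤSeries → ℤSeries
q^ zero  · f = f
q^ suc e · f = shift₁ (q^ e · f)

infixr 7 1-q^_·_
1-q^_·_ : ℕ → ℤSeries → ℤSeries
1-q^ d · f = f ⊕ ⊖ (q^ d · f)

⊗-congˡ : ∀ {f f′} → f ≗ f′ → ∀ g → f ⊗ g ≗ f′ ⊗ g
⊗-congˡ eq g zero    = cong (_* g 0) (eq 0)
⊗-congˡ eq g (suc n) = cong₂ _+_ (cong (_* g (suc n)) (eq 0)) (⊗-congˡ (eq ∘ suc) g n)

⊗-congʳ : ∀ f {g g′} → g ≗ g′ → f ⊗ g ≗ f ⊗ g′
⊗-congʳ f eq zero    = cong (f 0 *_) (eq 0)
⊗-congʳ f eq (suc n) = cong₂ _+_ (cong (f 0 *_) (eq (suc n))) (⊗-congʳ (tail f) eq n)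

⊗-cong : ∀ {f f′ g g′} → f ≗ f′ → g ≗ g′ → f ⊗ g ≗ f′ ⊗ g′
⊗-cong {f′ = f′} {g = g} eq eq′ n = trans (⊗-congˡ eq g n) (⊗-congʳ f′ eq′ n)

⊗-distribʳ-⊕ : ∀ h f g → (f ⊕ g) ⊗ h ≗ f ⊗ h ⊕ g ⊗ h
⊗-distribʳ-⊕ h f g zero    = ℤₚ.*-distribʳ-+ (h 0) (f 0) (g 0)
⊗-distribʳ-⊕ h f g (suc n) =
  trans (cong (λ z → (f 0 + g 0) * h (suc n) + z) (⊗-distribʳ-⊕ h (tail f) (tail g) n))
        (regroup (f 0) (g 0) (h (suc n)) _ _)
  where
  regroup : ∀ x y z a b → (x + y) * z + (a + b) ≡ (x * z + a) + (y * z + b)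
  regroup = solve-∀

⊗-•ˡ : ∀ c f g → (c • f) ⊗ g ≗ c • (f ⊗ g)
⊗-•ˡ c f g zero    = ℤₚ.*-assoc c (f 0) (g 0)
⊗-•ˡ c f g (suc n) =
  trans (cong (λ z → (c * f 0) * g (suc n) + z) (⊗-•ˡ c (tail f) g n))
        (factor-out c (f 0) (g (suc n)) _)
  where
  factor-out : ∀ c x z a → (c * x) * z + c * a ≡ c * (x * z + a)
  factor-out = solve-∀

⊗-zeroˡ : ∀ g → 0ˢ ⊗ g ≗ 0ˢ
⊗-zeroˡ g zero    = refl
⊗-zeroˡ g (suc n) = trans (ℤₚ.+-identityˡ _) (⊗-zeroˡ g n)

⊗-identityˡ : ∀ g → 1ˢ ⊗ g ≗ g
⊗-identityˡ g zero    = ℤₚ.*-identityˡ (g 0)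
⊗-identityˡ g (suc n) =
  trans (cong (λ z → 1ℤ * g (suc n) + z) (⊗-zeroˡ g n))
        (trans (ℤₚ.+-identityʳ _) (ℤₚ.*-identityˡ _))

⊗-unfoldʳ : ∀ f g n → (f ⊗ g) (suc n) ≡ f (suc n) * g 0 + (f ⊗ tail g) n
⊗-unfoldʳ f g zero    = ℤₚ.+-comm (f 0 * g 1) (f 1 * g 0)
⊗-unfoldʳ f g (suc n) =
  trans (cong (λ z → f 0 * g (suc (suc n)) + z) (⊗-unfoldʳ (tail f) g n))
        (swap (f 0 * g (suc (suc n))) (f (suc (suc n)) * g 0) ((tail f ⊗ tail g) n))
  where
  swap : ∀ a b c → a + (b + c) ≡ b + (a + c)
  swap = solve-∀

⊗-comm : ∀ f g → f ⊗ g ≗ g ⊗ f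
⊗-comm f g zero    = ℤₚ.*-comm (f 0) (g 0)
⊗-comm f g (suc n) =
  trans (cong₂ _+_ (ℤₚ.*-comm (f 0) (g (suc n))) (⊗-comm (tail f) g n))
        (sym (⊗-unfoldʳ g f n))

⊗-assoc : ∀ f g h → (f ⊗ g) ⊗ h ≗ f ⊗ (g ⊗ h)
⊗-assoc f g h zero    = ℤₚ.*-assoc (f 0) (g 0) (h 0)
⊗-assoc f g h (suc n) = begin
  (f ⊗ g) 0 * h (suc n) + (tail (f ⊗ g) ⊗ h) n
    ≡⟨ cong (λ z → (f ⊗ g) 0 * h (suc n) + z) tail-step ⟩
  (f ⊗ g) 0 * h (suc n) + (f 0 * (tail g ⊗ h) n + (tail f ⊗ (g ⊗ h)) n)
    ≡⟨ regroup (f 0) (g 0) (h (suc n)) _ _ ⟩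
  f 0 * (g ⊗ h) (suc n) + (tail f ⊗ (g ⊗ h)) n
    ∎
  where
  open ≡-Reasoning
  tail-step : (tail (f ⊗ g) ⊗ h) n ≡ f 0 * (tail g ⊗ h) n + (tail f ⊗ (g ⊗ h)) n
  tail-step = trans (⊗-distribʳ-⊕ h (f 0 • tail g) (tail f ⊗ g) n)
                    (cong₂ _+_ (⊗-•ˡ (f 0) (tail g) h n) (⊗-assoc (tail f) g h n))
  regroup : ∀ a b c d e → (a * b) * c + (a * d + e) ≡ a * (b * c + d) + e
  regroup = solve-∀

⊗-•ʳ : ∀ c f g → f ⊗ (c • g) ≗ c • (f ⊗ g)
⊗-•ʳ c f g n = trans (⊗-comm f (c • g) n) (trans (⊗-•ˡ c g f n) (cong (c *_) (⊗-comm g f n)))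

⊗-⊖ˡ : ∀ f g → (⊖ f) ⊗ g ≗ ⊖ (f ⊗ g)
⊗-⊖ˡ f g n =
  trans (⊗-congˡ (λ k → sym (ℤₚ.-1*i≡-i (f k))) g n)
        (trans (⊗-•ˡ (- 1ℤ) f g n) (ℤₚ.-1*i≡-i _))

⊗-identityʳ : ∀ f → f ⊗ 1ˢ ≗ f
⊗-identityʳ f n = trans (⊗-comm f 1ˢ n) (⊗-identityˡ f n)

⊗-∑ˡ : ∀ m F g → ∑ˢ m F ⊗ g ≗ ∑ˢ m (λ i → F i ⊗ g)
⊗-∑ˡ zero    F g n = ⊗-zeroˡ g n
⊗-∑ˡ (suc m) F g n =
  trans (⊗-distribʳ-⊕ g (F 0) (∑ˢ m (F ∘ suc)) n)
        (cong (λ z → (F 0 ⊗ g) n + z) (⊗-∑ˡ m (F ∘ suc) g n))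

⊗-∑ʳ : ∀ m f G → f ⊗ ∑ˢ m G ≗ ∑ˢ m (λ i → f ⊗ G i)
⊗-∑ʳ m f G n =
  trans (⊗-comm f (∑ˢ m G) n)
        (trans (⊗-∑ˡ m G f n) (∑-cong m (λ i _ → ⊗-comm (G i) f n)))

q^-cong : ∀ e {f g} → f ≗ g → q^ e · f ≗ q^ e · g
q^-cong zero    eq = eq
q^-cong (suc e) eq zero    = refl
q^-cong (suc e) eq (suc n) = q^-cong e eq n

q^-below : ∀ e f n → n < e → (q^ e · f) n ≡ 0ℤ
q^-below (suc e) f zero    _         = refl
q^-below (suc e) f (suc n) (s≤s n<e) = q^-below e f n n<e

q^-at : ∀ e f n → (q^ e · f) (e ℕ.+ n) ≡ f n
q^-at zero    f n = refl
q^-at (suc e) f n = q^-at e f n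

q^-+ : ∀ a b f → q^ a · q^ b · f ≗ q^ (a ℕ.+ b) · f
q^-+ zero    b f n       = refl
q^-+ (suc a) b f zero    = refl
q^-+ (suc a) b f (suc n) = q^-+ a b f n

q^-exponents : ∀ a b c d f → a ℕ.+ b ≡ c ℕ.+ d → q^ a · q^ b · f ≗ q^ c · q^ d · f
q^-exponents a b c d f eq n =
  trans (q^-+ a b f n) (trans (cong (λ k → (q^ k · f) n) eq) (sym (q^-+ c d f n)))

q^-zero : ∀ e {f} → f ≗ 0ˢ → q^ e · f ≗ 0ˢ
q^-zero zero    eq = eq
q^-zero (suc e) eq zero    = refl
q^-zero (suc e) eq (suc n) = q^-zero e eq n

q^-⊕ : ∀ e f g → q^ e · (f ⊕ g) ≗ q^ e · f ⊕ q^ e · g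
q^-⊕ zero    f g n       = refl
q^-⊕ (suc e) f g zero    = refl
q^-⊕ (suc e) f g (suc n) = q^-⊕ e f g n

q^-• : ∀ e c f → q^ e · (c • f) ≗ c • q^ e · f
q^-• zero    c f n       = refl
q^-• (suc e) c f zero    = sym (ℤₚ.*-zeroʳ c)
q^-• (suc e) c f (suc n) = q^-• e c f n

q^-⊖ : ∀ e f → q^ e · (⊖ f) ≗ ⊖ (q^ e · f)
q^-⊖ zero    f n       = refl
q^-⊖ (suc e) f zero    = refl
q^-⊖ (suc e) f (suc n) = q^-⊖ e f n

q^-∑ : ∀ e m F → q^ e · ∑ˢ m F ≗ ∑ˢ m (λ i → q^ e · F i)
q^-∑ zero    m F n       = refl
q^-∑ (suc e) m F zero    = sym (∑-zero m)
q^-∑ (suc e) m F (suc n) = q^-∑ e m F n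

q^-⊗ˡ : ∀ e f g → (q^ e · f) ⊗ g ≗ q^ e · (f ⊗ g)
q^-⊗ˡ zero    f g n       = refl
q^-⊗ˡ (suc e) f g zero    = refl
q^-⊗ˡ (suc e) f g (suc n) = trans (ℤₚ.+-identityˡ _) (q^-⊗ˡ e f g n)

q^-⊗ʳ : ∀ e f g → f ⊗ (q^ e · g) ≗ q^ e · (f ⊗ g)
q^-⊗ʳ e f g n =
  trans (⊗-comm f (q^ e · g) n) (trans (q^-⊗ˡ e g f n) (q^-cong e (⊗-comm g f) n))

1-q^-⊗ˡ : ∀ d f g → (1-q^ d · f) ⊗ g ≗ 1-q^ d · (f ⊗ g)
1-q^-⊗ˡ d f g n =
  trans (⊗-distribʳ-⊕ g f (⊖ (q^ d · f)) n)
        (cong (λ z → (f ⊗ g) n + z)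
              (trans (⊗-⊖ˡ (q^ d · f) g n) (cong -_ (q^-⊗ˡ d f g n))))

1-q^-cong : ∀ d {f g} → f ≗ g → 1-q^ d · f ≗ 1-q^ d · g
1-q^-cong d eq n = cong₂ _+_ (eq n) (cong -_ (q^-cong d eq n))

1-q^-zero : ∀ d {f} → f ≗ 0ˢ → 1-q^ d · f ≗ 0ˢ
1-q^-zero d f≗0 t = cong₂ (λ x y → x + - y) (f≗0 t) (q^-zero d f≗0 t)

1-q^-⊗ʳ : ∀ d f g → f ⊗ (1-q^ d · g) ≗ 1-q^ d · (f ⊗ g)
1-q^-⊗ʳ d f g n =
  trans (⊗-comm f (1-q^ d · g) n) (trans (1-q^-⊗ˡ d g f n) (1-q^-cong d (⊗-comm g f) n))

1-q^-as-⊗ : ∀ d f → 1-q^ d · f ≗ f ⊗ (1-q^ d · 1ˢ)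
1-q^-as-⊗ d f n = sym (trans (1-q^-⊗ʳ d f 1ˢ n) (cong₂ _+_ (⊗-identityʳ f n)
                                                           (cong -_ (q^-cong d (⊗-identityʳ f) n))))

1-q^-squared : ∀ d f →
  1-q^ d · 1-q^ d · f ≗ f ⊕ q^ (d ℕ.+ d) · f ⊕ ⊖ (q^ d · f) ⊕ ⊖ (q^ d · f)
1-q^-squared d f n = begin
  f n - (q^ d · f) n + - (q^ d · (f ⊕ ⊖ (q^ d · f))) n
    ≡⟨ cong (λ z → f n - (q^ d · f) n + - z)
            (trans (q^-⊕ d f _ n) (cong (λ z → (q^ d · f) n + z) twice)) ⟩
  f n - (q^ d · f) n + - ((q^ d · f) n - (q^ (d ℕ.+ d) · f) n)
    ≡⟨ expand (f n) ((q^ d · f) n) ((q^ (d ℕ.+ d) · f) n) ⟩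
  f n + (q^ (d ℕ.+ d) · f) n + - (q^ d · f) n + - (q^ d · f) n
    ∎
  where
  open ≡-Reasoning
  twice : (q^ d · ⊖ (q^ d · f)) n ≡ - (q^ (d ℕ.+ d) · f) n
  twice = trans (q^-⊖ d (q^ d · f) n) (cong -_ (q^-+ d d f n))
  expand : ∀ a b c → a - b + - (b - c) ≡ a + c + - b + - b
  expand = solve-∀

infix 4 _≡_mod-q^_
_≡_mod-q^_ : ℤSeries → ℤSeries → ℕ → Set
f ≡ g mod-q^ N = ∀ n → n < N → f n ≡ g n

mod-sym : ∀ {f g N} → f ≡ g mod-q^ N → g ≡ f mod-q^ N
mod-sym eq n n<N = sym (eq n n<N)

mod-trans : ∀ {f g h N} → f ≡ g mod-q^ N → g ≡ h mod-q^ N → f ≡ h mod-q^ N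
mod-trans eq eq′ n n<N = trans (eq n n<N) (eq′ n n<N)

mod-weaken : ∀ {f g M N} → M ≤ N → f ≡ g mod-q^ N → f ≡ g mod-q^ M
mod-weaken M≤N eq n n<M = eq n (ℕₚ.<-≤-trans n<M M≤N)

mod-resp-≗ : ∀ {f f′ g g′ N} → f ≗ f′ → g ≗ g′ → f ≡ g mod-q^ N → f′ ≡ g′ mod-q^ N
mod-resp-≗ eqf eqg eq n n<N = trans (sym (eqf n)) (trans (eq n n<N) (eqg n))

⊕-mod : ∀ {f f′ g g′ N} → f ≡ f′ mod-q^ N → g ≡ g′ mod-q^ N → f ⊕ g ≡ f′ ⊕ g′ mod-q^ N
⊕-mod eq eq′ n n<N = cong₂ _+_ (eq n n<N) (eq′ n n<N)

⊖-mod : ∀ {f f′ N} → f ≡ f′ mod-q^ N → ⊖ f ≡ ⊖ f′ mod-q^ N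
⊖-mod eq n n<N = cong -_ (eq n n<N)

•-mod : ∀ {f f′ N} c → f ≡ f′ mod-q^ N → c • f ≡ c • f′ mod-q^ N
•-mod c eq n n<N = cong (c *_) (eq n n<N)

∑-mod : ∀ m {F G N} → (∀ i → i < m → F i ≡ G i mod-q^ N) → ∑ˢ m F ≡ ∑ˢ m G mod-q^ N
∑-mod m eq n n<N = ∑-cong m (λ i i<m → eq i i<m n n<N)

q^-mod : ∀ e {f g N} → f ≡ g mod-q^ N → q^ e · f ≡ q^ e · g mod-q^ (e ℕ.+ N)
q^-mod zero    eq = eq
q^-mod (suc e) eq zero    _           = refl
q^-mod (suc e) eq (suc n) (s≤s n<e+N) = q^-mod e eq n n<e+N

stable⇒converges : ∀ {F : ℕ → ℤSeries} → (∀ k → F (suc k) ≡ F k mod-q^ suc k) →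
                   ∀ {a b} → a ≤ b → F a ≡ F b mod-q^ suc a
stable⇒converges stable {a} {zero}  z≤n   = λ _ _ → refl
stable⇒converges stable {a} {suc b} a≤b+1 with ℕₚ.m≤n⇒m<n∨m≡n a≤b+1
... | inj₂ refl  = λ _ _ → refl
... | inj₁ a<b+1 = mod-trans (stable⇒converges stable (ℕₚ.≤-pred a<b+1))
                             (mod-sym (mod-weaken (s≤s (ℕₚ.≤-pred a<b+1)) (stable b)))

⊗-coefficient-local : ∀ n f f′ g g′ →
  (∀ i → i ≤ n → f i ≡ f′ i) → (∀ i → i ≤ n → g i ≡ g′ i) → (f ⊗ g) n ≡ (f′ ⊗ g′) n
⊗-coefficient-local zero    f f′ g g′ eqf eqg = cong₂ _*_ (eqf 0 z≤n) (eqg 0 z≤n)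
⊗-coefficient-local (suc n) f f′ g g′ eqf eqg =
  cong₂ _+_ (cong₂ _*_ (eqf 0 z≤n) (eqg (suc n) ℕₚ.≤-refl))
            (⊗-coefficient-local n (tail f) (tail f′) g g′
               (λ i i≤n → eqf (suc i) (s≤s i≤n)) (λ i i≤n → eqg i (ℕₚ.m≤n⇒m≤1+n i≤n)))

⊗-mod : ∀ {f f′ g g′ N} → f ≡ f′ mod-q^ N → g ≡ g′ mod-q^ N → f ⊗ g ≡ f′ ⊗ g′ mod-q^ N
⊗-mod {f} {f′} {g} {g′} eqf eqg n n<N =
  ⊗-coefficient-local n f f′ g g′ (λ i i≤n → eqf i (ℕₚ.≤-<-trans i≤n n<N))
                                  (λ i i≤n → eqg i (ℕₚ.≤-<-trans i≤n n<N))

-- Gaussian binomial coefficients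

qbinom : ℕ → ℕ → ℤSeries
qbinom zero    zero    = 1ˢ
qbinom zero    (suc r) = 0ˢ
qbinom (suc m) zero    = 1ˢ
qbinom (suc m) (suc r) = qbinom m r ⊕ q^ suc r · qbinom m (suc r)

qbinom-zeroʳ : ∀ m → qbinom m 0 ≗ 1ˢ
qbinom-zeroʳ zero    n = refl
qbinom-zeroʳ (suc m) n = refl

qbinom-vanish : ∀ m r → m < r → qbinom m r ≗ 0ˢ
qbinom-vanish zero    (suc r) _         n = refl
qbinom-vanish (suc m) (suc r) (s≤s m<r) n =
  cong₂ _+_ (qbinom-vanish m r m<r n)
            (q^-zero (suc r) (qbinom-vanish m (suc r) (ℕₚ.m≤n⇒m≤1+n m<r)) n)

-- When m ≤ r both sides vanish, so no hypothesis is needed.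
q^-qbinom-pred : ∀ m r → q^ (suc (suc r)) · q^ (m ∸ suc r) · qbinom m (suc r)
                         ≗ q^ (m ∸ r) · q^ (suc r) · qbinom m (suc r)
q^-qbinom-pred m r with ℕₚ.≤-<-connex (suc r) m
... | inj₁ r<m = q^-exponents (suc (suc r)) (m ∸ suc r) (m ∸ r) (suc r) (qbinom m (suc r)) exponents
  where
  exponents : suc (suc r) ℕ.+ (m ∸ suc r) ≡ (m ∸ r) ℕ.+ suc r
  exponents = trans (cong suc (ℕₚ.m+[n∸m]≡n r<m))
                    (sym (trans (ℕₚ.+-suc (m ∸ r) r) (cong suc (ℕₚ.m∸n+n≡m (ℕₚ.<⇒≤ r<m)))))
... | inj₂ m<r+1 = λ n →
  trans (q^-zero (suc (suc r)) (q^-zero (m ∸ suc r) vanish) n)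
        (sym (q^-zero (m ∸ r) (q^-zero (suc r) vanish) n))
  where vanish = qbinom-vanish m (suc r) m<r+1

qbinom-pascal′ : ∀ m r → qbinom (suc m) (suc r) ≗ q^ (m ∸ r) · qbinom m r ⊕ qbinom m (suc r)
qbinom-pascal′ zero    zero    n = cong (λ z → 1ˢ n + z) (q^-zero 1 (λ _ → refl) n)
qbinom-pascal′ zero    (suc r) n = cong (λ z → 0ℤ + z) (q^-zero (suc (suc r)) (λ _ → refl) n)
qbinom-pascal′ (suc m) zero    n = begin
  1ˢ n + (q^ 1 · qbinom (suc m) 1) n
    ≡⟨ cong (λ z → 1ˢ n + z) (q^-cong 1 (qbinom-pascal′ m zero) n) ⟩
  1ˢ n + (q^ 1 · (q^ m · qbinom m 0 ⊕ qbinom m 1)) n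
    ≡⟨ cong (λ z → 1ˢ n + z) (q^-⊕ 1 (q^ m · qbinom m 0) (qbinom m 1) n) ⟩
  1ˢ n + ((q^ suc m · qbinom m 0) n + (q^ 1 · qbinom m 1) n)
    ≡⟨ swap (1ˢ n) ((q^ suc m · qbinom m 0) n) ((q^ 1 · qbinom m 1) n) ⟩
  (q^ suc m · qbinom m 0) n + (1ˢ n + (q^ 1 · qbinom m 1) n)
    ≡⟨ cong₂ (λ x y → x + (y + (q^ 1 · qbinom m 1) n))
             (q^-cong (suc m) (qbinom-zeroʳ m) n) (sym (qbinom-zeroʳ m n)) ⟩
  (q^ suc m · 1ˢ) n + qbinom (suc m) 1 n
    ∎
  where
  open ≡-Reasoning
  swap : ∀ a b c → a + (b + c) ≡ b + (a + c)
  swap = solve-∀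
qbinom-pascal′ (suc m) (suc r) n = begin
  qbinom (suc m) (suc r) n + (q^ suc (suc r) · qbinom (suc m) (suc (suc r))) n
    ≡⟨ cong₂ _+_ (qbinom-pascal′ m r n) (q^-cong (suc (suc r)) (qbinom-pascal′ m (suc r)) n) ⟩
  (X n + Y n) + (q^ suc (suc r) · (q^ (m ∸ suc r) · Y ⊕ W)) n
    ≡⟨ cong (λ z → (X n + Y n) + z) (q^-⊕ (suc (suc r)) (q^ (m ∸ suc r) · Y) W n) ⟩
  (X n + Y n) + ((q^ suc (suc r) · q^ (m ∸ suc r) · Y) n + (q^ suc (suc r) · W) n)
    ≡⟨ cong (λ z → (X n + Y n) + (z + (q^ suc (suc r) · W) n)) (q^-qbinom-pred m r n) ⟩
  (X n + Y n) + ((q^ (m ∸ r) · q^ suc r · Y) n + (q^ suc (suc r) · W) n)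
    ≡⟨ interchange (X n) (Y n) _ _ ⟩
  (X n + (q^ (m ∸ r) · q^ suc r · Y) n) + (Y n + (q^ suc (suc r) · W) n)
    ≡⟨ cong (λ z → z + qbinom (suc m) (suc (suc r)) n) (sym (q^-⊕ (m ∸ r) (qbinom m r) (q^ suc r · Y) n)) ⟩
  (q^ (m ∸ r) · qbinom (suc m) (suc r)) n + qbinom (suc m) (suc (suc r)) n
    ∎
  where
  open ≡-Reasoning
  X = q^ (m ∸ r) · qbinom m r
  Y = qbinom m (suc r)
  W = qbinom m (suc (suc r))
  interchange : ∀ a b c d → (a + b) + (c + d) ≡ (a + c) + (b + d)
  interchange = solve-∀

previous : (ℕ → ℤSeries) → ℕ → ℤSeries
previous a zero    = 0ˢ
previous a (suc j) = a j

-- One Pascal step of each kind: the recursion in steps of two that jacobiBinomial needs.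
qbinom-double-step : ∀ m j →
  qbinom (suc (suc m)) (suc j) ≗ qbinom m j ⊕ q^ suc m · qbinom m j
                                 ⊕ q^ (suc m ∸ j) · previous (qbinom m) j
                                 ⊕ q^ suc j · qbinom m (suc j)
qbinom-double-step m j n =
  trans (cong₂ _+_ (outer j n) inner)
        (regroup (qbinom m j n) ((q^ (suc m ∸ j) · previous (qbinom m) j) n)
                 ((q^ suc m · qbinom m j) n) ((q^ suc j · qbinom m (suc j)) n))
  where
  outer : ∀ j → qbinom (suc m) j ≗ qbinom m j ⊕ q^ (suc m ∸ j) · previous (qbinom m) j
  outer zero    n = trans (sym (qbinom-zeroʳ m n))
                          (sym (trans (cong (λ z → qbinom m 0 n + z) (q^-zero (suc m) (λ _ → refl) n))
                                      (ℤₚ.+-identityʳ _)))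
  outer (suc j) n = trans (qbinom-pascal′ m j n) (ℤₚ.+-comm _ (qbinom m (suc j) n))
  shifted : (q^ suc j · q^ (m ∸ j) · qbinom m j) n ≡ (q^ suc m · qbinom m j) n
  shifted with ℕₚ.≤-<-connex j m
  ... | inj₁ j≤m = trans (q^-+ (suc j) (m ∸ j) (qbinom m j) n)
                         (cong (λ k → (q^ k · qbinom m j) n) (cong suc (ℕₚ.m+[n∸m]≡n j≤m)))
  ... | inj₂ m<j = trans (q^-zero (suc j) (q^-zero (m ∸ j) (qbinom-vanish m j m<j)) n)
                         (sym (q^-zero (suc m) (qbinom-vanish m j m<j) n))
  inner : (q^ suc j · qbinom (suc m) (suc j)) n
          ≡ (q^ suc m · qbinom m j) n + (q^ suc j · qbinom m (suc j)) n
  inner = trans (q^-cong (suc j) (qbinom-pascal′ m j) n)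
                (trans (q^-⊕ (suc j) (q^ (m ∸ j) · qbinom m j) (qbinom m (suc j)) n)
                       (cong (_+ (q^ suc j · qbinom m (suc j)) n) shifted))
  regroup : ∀ a c b d → (a + c) + (b + d) ≡ ((a + b) + c) + d
  regroup = solve-∀

-- Euler's product (q; q)ₙ = ∏ⱼ₌₁ⁿ (1 - qʲ)

euler : ℕ → ℤSeries
euler zero    = 1ˢ
euler (suc n) = 1-q^ suc n · euler n

euler-stable : ∀ k → euler (suc k) ≡ euler k mod-q^ suc k
euler-stable k n n<k+1 =
  trans (cong (λ z → euler k n + - z) (q^-below (suc k) (euler k) n n<k+1)) (ℤₚ.+-identityʳ _)

-- since [m, r] (q; q)ᵣ = (q^(m-r+1); q)ᵣ
qbinom-⊗-euler : ∀ m r → r ≤ m → qbinom m r ⊗ euler r ≡ 1ˢ mod-q^ suc (m ∸ r)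
qbinom-⊗-euler m zero _ n _ = trans (⊗-congˡ (qbinom-zeroʳ m) 1ˢ n) (⊗-identityˡ 1ˢ n)
qbinom-⊗-euler (suc m) (suc r) (s≤s r≤m) =
  mod-resp-≗ (λ n → sym (unfold n)) collapse (⊕-mod first second)
  where
  A = qbinom m r
  C = qbinom m (suc r)
  N = suc (m ∸ r)
  unfold : qbinom (suc m) (suc r) ⊗ euler (suc r) ≗ A ⊗ euler (suc r) ⊕ q^ suc r · (C ⊗ euler (suc r))
  unfold n = trans (⊗-distribʳ-⊕ (euler (suc r)) A (q^ suc r · C) n)
                   (cong (λ z → (A ⊗ euler (suc r)) n + z) (q^-⊗ˡ (suc r) C (euler (suc r)) n))
  first : A ⊗ euler (suc r) ≡ 1-q^ suc r · 1ˢ mod-q^ N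
  first = mod-resp-≗ (λ n → sym (1-q^-⊗ʳ (suc r) A (euler r) n)) (λ _ → refl)
            (⊕-mod IH (⊖-mod (mod-weaken (ℕₚ.m≤n+m N (suc r)) (q^-mod (suc r) IH))))
    where IH = qbinom-⊗-euler m r r≤m
  second : q^ suc r · (C ⊗ euler (suc r)) ≡ q^ suc r · 1ˢ mod-q^ N
  second with ℕₚ.≤-<-connex (suc r) m
  ... | inj₁ r<m = mod-weaken N≤ (q^-mod (suc r) (qbinom-⊗-euler m (suc r) r<m))
    where
    N≤ : N ≤ suc r ℕ.+ suc (m ∸ suc r)
    N≤ = ℕₚ.≤-trans (s≤s (ℕₚ.≤-reflexive (ℕₚ.+-∸-assoc 1 r<m)))
                    (ℕₚ.+-monoˡ-≤ (suc (m ∸ suc r)) (s≤s z≤n))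
  ... | inj₂ m<r+1 = λ { zero _ → refl
                       ; (suc n) (s≤s n<m∸r) → ⊥-elim (ℕₚ.n≮0 (ℕₚ.<-≤-trans n<m∸r
                                               (ℕₚ.≤-reflexive (ℕₚ.m≤n⇒m∸n≡0 (ℕₚ.≤-pred m<r+1))))) }
  collapse : 1-q^ suc r · 1ˢ ⊕ q^ suc r · 1ˢ ≗ 1ˢ
  collapse n = cancel (1ˢ n) ((q^ suc r · 1ˢ) n)
    where
    cancel : ∀ a b → (a + - b) + b ≡ a
    cancel = solve-∀

-- A finite form of Jacobi's identity

-- k ↦ k(k+1)/2 on ℤ; it takes the value tri m at both m and -1-m.
triℤ : ℤ → ℕ
triℤ (+ m)    = tri m
triℤ -[1+ m ] = tri m

triℤ-suc : ∀ k → + triℤ (1ℤ + k) ≡ + triℤ k + (1ℤ + k)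
triℤ-suc (+ m)          = trans (ℤₚ.pos-+ (suc m) (tri m)) (ℤₚ.+-comm (+ suc m) (+ tri m))
triℤ-suc -[1+ zero ]    = refl
triℤ-suc -[1+ suc m ]   =
  sym (trans (cong (_+ -[1+ m ]) (ℤₚ.pos-+ (suc m) (tri m))) (cancel (+ suc m) (+ tri m)))
  where
  cancel : ∀ a b → (a + b) + (- a) ≡ b
  cancel = solve-∀

-- 2n + 1, defined so that width (suc n) reduces to 2 + width n
width : ℕ → ℕ
width zero    = 1
width (suc n) = suc (suc (width n))

width≡ : ∀ n → width n ≡ suc (n ℕ.+ n)
width≡ zero    = refl
width≡ (suc n) = cong (suc ∘ suc) (trans (width≡ n) (sym (ℕₚ.+-suc n n)))

n+n<width : ∀ n → n ℕ.+ n < width n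
n+n<width n = ℕₚ.≤-reflexive (sym (width≡ n))

exponent : ℕ → ℕ → ℕ
exponent n i = triℤ (+ i - + suc n)

exponent-suc : ∀ n i → exponent (suc n) (suc i) ≡ exponent n i
exponent-suc n i = cong triℤ (shift-both (+ i) (+ suc n))
  where
  shift-both : ∀ a b → (1ℤ + a) - (1ℤ + b) ≡ a - b
  shift-both = solve-∀

exponent-step : ∀ n i → + exponent n (suc i) ≡ + exponent n i + ((1ℤ + + i) - + suc n)
exponent-step n i =
  trans (cong (λ z → + triℤ z) (assoc (+ i) (+ suc n)))
        (trans (triℤ-suc (+ i - + suc n)) (cong (λ z → + exponent n i + z) (sym (assoc (+ i) (+ suc n)))))
  where
  assoc : ∀ a b → (1ℤ + a) - b ≡ 1ℤ + (a - b)
  assoc = solve-∀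

exponent-up : ∀ n j → suc n ℕ.+ exponent n (suc j) ≡ exponent n j ℕ.+ suc j
exponent-up n j = ℤₚ.+-injective (begin
  + (suc n ℕ.+ exponent n (suc j))                               ≡⟨ ℤₚ.pos-+ (suc n) _ ⟩
  + suc n + + exponent n (suc j)
    ≡⟨ cong (λ z → + suc n + z) (exponent-step n j) ⟩
  (1ℤ + + n) + (+ exponent n j + ((1ℤ + + j) - (1ℤ + + n)))      ≡⟨ simplify (+ n) (+ exponent n j) (+ j) ⟩
  + exponent n j + (1ℤ + + j)                                    ≡⟨ sym (ℤₚ.pos-+ (exponent n j) (suc j)) ⟩
  + (exponent n j ℕ.+ suc j)                                     ∎)
  where
  open ≡-Reasoning
  simplify : ∀ n a j → (1ℤ + n) + (a + ((1ℤ + j) - (1ℤ + n))) ≡ a + (1ℤ + j)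
  simplify = solve-∀

exponent-down : ∀ n j → j ≤ width n → suc n ℕ.+ exponent n j ≡ exponent n (suc j) ℕ.+ (width n ∸ j)
exponent-down n j j≤w = ℤₚ.+-injective (begin
  + (suc n ℕ.+ exponent n j)                                           ≡⟨ ℤₚ.pos-+ (suc n) _ ⟩
  (1ℤ + + n) + + exponent n j                                          ≡⟨ simplify (+ n) (+ exponent n j) (+ j) ⟩
  (+ exponent n j + ((1ℤ + + j) - (1ℤ + + n))) + ((1ℤ + (+ n + + n)) - + j)
    ≡⟨ cong₂ _+_ (sym (exponent-step n j)) (cong (_- + j) (sym width≡ℤ)) ⟩
  + exponent n (suc j) + (+ width n - + j)
    ≡⟨ cong (λ z → + exponent n (suc j) + z) (trans (ℤₚ.m-n≡m⊖n (width n) j) (ℤₚ.⊖-≥ j≤w)) ⟩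
  + exponent n (suc j) + + (width n ∸ j)
    ≡⟨ sym (ℤₚ.pos-+ (exponent n (suc j)) _) ⟩
  + (exponent n (suc j) ℕ.+ (width n ∸ j))                             ∎)
  where
  open ≡-Reasoning
  width≡ℤ : + width n ≡ 1ℤ + (+ n + + n)
  width≡ℤ = trans (cong +_ (width≡ n))
                  (trans (ℤₚ.pos-+ 1 (n ℕ.+ n)) (cong (λ z → 1ℤ + z) (ℤₚ.pos-+ n n)))
  simplify : ∀ n a j → (1ℤ + n) + a ≡ (a + ((1ℤ + j) - (1ℤ + n))) + ((1ℤ + (n + n)) - j)
  simplify = solve-∀

∑ˢ-cong : ∀ m {F G} → (∀ i → i < m → F i ≗ G i) → ∑ˢ m F ≗ ∑ˢ m G
∑ˢ-cong m eq n = ∑-cong m (λ i i<m → eq i i<m n)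

∑ˢ-vanishing : ∀ m n F → m ≤ n → (∀ i → m ≤ i → F i ≗ 0ˢ) → ∑ˢ n F ≗ ∑ˢ m F
∑ˢ-vanishing m n F m≤n vanish t = ∑-vanishing m n (λ i → F i t) m≤n (λ i m≤i → vanish i m≤i t)

∑ˢ-quadratic : ∀ m c d F G H K →
  ∑ˢ m (λ j → F j ⊕ q^ c · G j ⊕ ⊖ (q^ d · H j) ⊕ ⊖ (q^ d · K j))
  ≗ ∑ˢ m F ⊕ q^ c · ∑ˢ m G ⊕ ⊖ (q^ d · ∑ˢ m H) ⊕ ⊖ (q^ d · ∑ˢ m K)
∑ˢ-quadratic m c d F G H K t = begin
  ∑[ j < m ] (F j t + (q^ c · G j) t + - (q^ d · H j) t + - (q^ d · K j) t)
    ≡⟨ ∑-distrib-+ m _ _ ⟩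
  ∑[ j < m ] (F j t + (q^ c · G j) t + - (q^ d · H j) t) + ∑[ j < m ] (- (q^ d · K j) t)
    ≡⟨ cong₂ _+_ (trans (∑-distrib-+ m _ _) (cong₂ _+_ (∑-distrib-+ m _ _) (∑-neg m _))) (∑-neg m _) ⟩
  ∑ˢ m F t + ∑[ j < m ] (q^ c · G j) t + - ∑[ j < m ] (q^ d · H j) t + - ∑[ j < m ] (q^ d · K j) t
    ≡⟨ sym (cong₂ _+_ (cong₂ _+_ (cong (λ z → ∑ˢ m F t + z) (q^-∑ c m G t)) (cong -_ (q^-∑ d m H t)))
                      (cong -_ (q^-∑ d m K t))) ⟩
  ∑ˢ m F t + (q^ c · ∑ˢ m G) t + - (q^ d · ∑ˢ m H) t + - (q^ d · ∑ˢ m K) t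
    ∎
  where open ≡-Reasoning

•-quadratic : ∀ m c d x y z k →
  m • (x ⊕ q^ c · y ⊕ ⊖ (q^ d · z) ⊕ ⊖ (q^ d · k))
  ≗ m • x ⊕ q^ c · (m • y) ⊕ ⊖ (q^ d · (m • z)) ⊕ ⊖ (q^ d · (m • k))
•-quadratic m c d x y z k t =
  trans (distribute m (x t) _ _ _)
        (sym (cong₂ _+_ (cong₂ _+_ (cong (λ w → m * x t + w) (q^-• c m y t)) (cong -_ (q^-• d m z t)))
                        (cong -_ (q^-• d m k t))))
  where
  distribute : ∀ m x y z k → m * (x + y + - z + - k) ≡ m * x + m * y + - (m * z) + - (m * k)
  distribute = solve-∀

-- Σᵢ a′ᵢ zⁱ = (z - q^d)(1 - q^d z) Σᵢ aᵢ zⁱ, where aᵢ = 0 for i ≥ b.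
record IsQuadraticMultiple (d b : ℕ) (a a′ : ℕ → ℤSeries) : Set where
  field
    vanish   : ∀ i → b ≤ i → a i ≗ 0ˢ
    constant : a′ 0 ≗ ⊖ (q^ d · a 0)
    step     : ∀ j → j ≤ b →
               a′ (suc j) ≗ a j ⊕ q^ (d ℕ.+ d) · a j ⊕ ⊖ (q^ d · previous a j) ⊕ ⊖ (q^ d · a (suc j))

module _ {d b a a′} (mult : IsQuadraticMultiple d b a a′) where

  open IsQuadraticMultiple mult

  private
    S = ∑ˢ b a
    M = ∑ˢ b (λ i → + i • a i)

    ∑-a : ∀ {m} → b ≤ m → ∑ˢ m a ≗ S
    ∑-a b≤m = ∑ˢ-vanishing b _ a b≤m vanish

    ∑-moment : ∀ {m} → b ≤ m → ∑ˢ m (λ i → + i • a i) ≗ M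
    ∑-moment b≤m = ∑ˢ-vanishing b _ _ b≤m
                     (λ i b≤i t → trans (cong (+ i *_) (vanish i b≤i t)) (ℤₚ.*-zeroʳ (+ i)))

    ∑-suc•current : S ≗ 0ˢ → ∑ˢ (suc b) (λ j → + suc j • a j) ≗ M
    ∑-suc•current S≗0 t = begin
      ∑[ j < suc b ] (+ suc j * a j t)
        ≡⟨ ∑-cong (suc b) (λ j _ → split (+ j) (a j t)) ⟩
      ∑[ j < suc b ] (+ j * a j t + a j t)
        ≡⟨ ∑-distrib-+ (suc b) (λ j → + j * a j t) (λ j → a j t) ⟩
      ∑[ j < suc b ] (+ j * a j t) + ∑ˢ (suc b) a t
        ≡⟨ cong₂ _+_ (∑-moment (ℕₚ.n≤1+n b) t) (trans (∑-a (ℕₚ.n≤1+n b) t) (S≗0 t)) ⟩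
      M t + 0ℤ
        ≡⟨ ℤₚ.+-identityʳ _ ⟩
      M t
        ∎
      where
      open ≡-Reasoning
      split : ∀ j x → (1ℤ + j) * x ≡ j * x + x
      split = solve-∀

    ∑-suc•previous : S ≗ 0ˢ → ∑ˢ (suc b) (λ j → + suc j • previous a j) ≗ M
    ∑-suc•previous S≗0 t = begin
      + 1 * 0ℤ + ∑[ j < b ] (+ suc (suc j) * a j t)
        ≡⟨ cong (λ z → + 1 * 0ℤ + z) (∑-cong b (λ j _ → split (+ j) (a j t))) ⟩
      + 1 * 0ℤ + ∑[ j < b ] (+ j * a j t + (a j t + a j t))
        ≡⟨ cong (λ z → + 1 * 0ℤ + z)
                (trans (∑-distrib-+ b _ _) (cong (λ z → M t + z) (∑-distrib-+ b _ _))) ⟩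
      + 1 * 0ℤ + (M t + (S t + S t))
        ≡⟨ cong (λ z → + 1 * 0ℤ + (M t + (z + z))) (S≗0 t) ⟩
      + 1 * 0ℤ + (M t + (0ℤ + 0ℤ))
        ≡⟨ simplify (M t) ⟩
      M t
        ∎
      where
      open ≡-Reasoning
      split : ∀ j x → (1ℤ + (1ℤ + j)) * x ≡ j * x + (x + x)
      split = solve-∀
      simplify : ∀ y → + 1 * 0ℤ + (y + (0ℤ + 0ℤ)) ≡ y
      simplify = solve-∀

    ∑-suc•next : ∑ˢ (suc b) (λ j → + suc j • a (suc j)) ≗ M
    ∑-suc•next t = trans (sym (ℤₚ.+-identityˡ _)) (∑-moment (ℕₚ.m≤n+m b 2) t)

  ∑-quadraticMultiple : ∑ˢ (suc (suc b)) a′ ≗ 1-q^ d · 1-q^ d · S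
  ∑-quadraticMultiple t = begin
    a′ 0 t + ∑[ j < suc b ] a′ (suc j) t
      ≡⟨ cong₂ _+_ (constant t) (trans (∑ˢ-cong (suc b) (λ j j<b+1 → step j (ℕₚ.≤-pred j<b+1)) t)
                                       (∑ˢ-quadratic (suc b) (d ℕ.+ d) d a a (previous a) (a ∘ suc) t)) ⟩
    - x + (∑ˢ (suc b) a t + (q^ (d ℕ.+ d) · ∑ˢ (suc b) a) t + - (q^ d · ∑ˢ (suc b) (previous a)) t + - Q)
      ≡⟨ cong (λ z → - x + (z + - Q))
              (cong₂ _+_ (cong₂ _+_ (∑-a (ℕₚ.n≤1+n b) t) (q^-cong (d ℕ.+ d) (∑-a (ℕₚ.n≤1+n b)) t))
                         (cong -_ (q^-cong d (λ k → ℤₚ.+-identityˡ (S k)) t))) ⟩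
    - x + (S t + (q^ (d ℕ.+ d) · S) t + - (q^ d · S) t + - Q)
      ≡⟨ cong (λ z → - x + (S t + (q^ (d ℕ.+ d) · S) t + - (q^ d · S) t + - z)) Q≡ ⟩
    - x + (S t + (q^ (d ℕ.+ d) · S) t + - (q^ d · S) t + - ((q^ d · S) t - x))
      ≡⟨ cancel x (S t) ((q^ (d ℕ.+ d) · S) t) ((q^ d · S) t) ⟩
    (S ⊕ q^ (d ℕ.+ d) · S ⊕ ⊖ (q^ d · S) ⊕ ⊖ (q^ d · S)) t
      ≡⟨ sym (1-q^-squared d S t) ⟩
    (1-q^ d · 1-q^ d · S) t
      ∎
    where
    open ≡-Reasoning
    x = (q^ d · a 0) t
    Q = (q^ d · ∑ˢ (suc b) (a ∘ suc)) t
    Q≡ : Q ≡ (q^ d · S) t - x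
    Q≡ = begin
      Q                                          ≡⟨ add-sub Q x ⟩
      (x + Q) - x
        ≡⟨ cong (_- x) (sym (q^-⊕ d (a 0) (∑ˢ (suc b) (a ∘ suc)) t)) ⟩
      (q^ d · ∑ˢ (suc (suc b)) a) t - x          ≡⟨ cong (_- x) (q^-cong d (∑-a (ℕₚ.m≤n+m b 2)) t) ⟩
      (q^ d · S) t - x                           ∎
      where
      add-sub : ∀ q x → q ≡ (x + q) - x
      add-sub = solve-∀
    cancel : ∀ x s cs ds → - x + (s + cs + - ds + - (ds - x)) ≡ s + cs + - ds + - ds
    cancel = solve-∀

  -- the z-derivative at z = 1, when z = 1 is a root
  moment-quadraticMultiple : S ≗ 0ˢ → ∑ˢ (suc (suc b)) (λ i → + i • a′ i) ≗ 1-q^ d · 1-q^ d · M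
  moment-quadraticMultiple S≗0 t = begin
    + 0 * a′ 0 t + ∑[ j < suc b ] (+ suc j * a′ (suc j) t)
      ≡⟨ trans (ℤₚ.+-identityˡ _)
               (trans (∑ˢ-cong (suc b) expand t) (∑ˢ-quadratic (suc b) (d ℕ.+ d) d F F H K t)) ⟩
    (∑ˢ (suc b) F ⊕ q^ (d ℕ.+ d) · ∑ˢ (suc b) F
      ⊕ ⊖ (q^ d · ∑ˢ (suc b) H) ⊕ ⊖ (q^ d · ∑ˢ (suc b) K)) t
      ≡⟨ cong₂ _+_ (cong₂ _+_ (cong₂ _+_ (∑F t) (q^-cong (d ℕ.+ d) ∑F t)) (cong -_ (q^-cong d ∑H t)))
                   (cong -_ (q^-cong d (∑-suc•next) t)) ⟩
    (M ⊕ q^ (d ℕ.+ d) · M ⊕ ⊖ (q^ d · M) ⊕ ⊖ (q^ d · M)) t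
      ≡⟨ sym (1-q^-squared d M t) ⟩
    (1-q^ d · 1-q^ d · M) t
      ∎
    where
    open ≡-Reasoning
    F = λ j → + suc j • a j
    H = λ j → + suc j • previous a j
    K = λ j → + suc j • a (suc j)
    ∑F = ∑-suc•current S≗0
    ∑H = ∑-suc•previous S≗0
    expand : ∀ j → j < suc b → + suc j • a′ (suc j)
             ≗ F j ⊕ q^ (d ℕ.+ d) · F j ⊕ ⊖ (q^ d · H j) ⊕ ⊖ (q^ d · K j)
    expand j j<b+1 t = trans (cong (+ suc j *_) (step j (ℕₚ.≤-pred j<b+1) t))
                             (•-quadratic (+ suc j) (d ℕ.+ d) d (a j) (a j) (previous a j) (a (suc j)) t)

sign : ℕ → ℤ
sign zero    = 1ℤ
sign (suc k) = - sign k

sign-+ : ∀ a b → sign (a ℕ.+ b) ≡ sign a * sign b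
sign-+ zero    b = sym (ℤₚ.*-identityˡ (sign b))
sign-+ (suc a) b = trans (cong -_ (sign-+ a b)) (ℤₚ.neg-distribˡ-* (sign a) (sign b))

sign-square : ∀ a → sign a * sign a ≡ 1ℤ
sign-square zero    = refl
sign-square (suc a) = trans (neg-square (sign a)) (sign-square a)
  where
  neg-square : ∀ s → (- s) * (- s) ≡ s * s
  neg-square = solve-∀

sign-cancel : ∀ a b → sign (a ℕ.+ (a ℕ.+ b)) ≡ sign b
sign-cancel a b = begin
  sign (a ℕ.+ (a ℕ.+ b))           ≡⟨ trans (sign-+ a _) (cong (sign a *_) (sign-+ a b)) ⟩
  sign a * (sign a * sign b)       ≡⟨ sym (ℤₚ.*-assoc (sign a) (sign a) (sign b)) ⟩
  (sign a * sign a) * sign b       ≡⟨ cong (_* sign b) (sign-square a) ⟩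
  1ℤ * sign b                      ≡⟨ ℤₚ.*-identityˡ (sign b) ⟩
  sign b                           ∎
  where open ≡-Reasoning

-- jacobiTerm n i is the coefficient of zⁱ in (z - 1) ∏ⱼ₌₁ⁿ (z - qʲ)(1 - qʲ z).
jacobiBinomial : ℕ → ℕ → ℤSeries
jacobiBinomial n i = q^ exponent n i · qbinom (width n) i

jacobiTerm : ℕ → ℕ → ℤSeries
jacobiTerm n i = sign (suc n ℕ.+ i) • jacobiBinomial n i

jacobiBinomial-step : ∀ n j → j ≤ suc (width n) →
  jacobiBinomial (suc n) (suc j)
  ≗ jacobiBinomial n j ⊕ q^ suc (width n) · jacobiBinomial n j
    ⊕ q^ suc n · previous (jacobiBinomial n) j ⊕ q^ suc n · jacobiBinomial n (suc j)
jacobiBinomial-step n j j≤w+1 t = begin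
  jacobiBinomial (suc n) (suc j) t
    ≡⟨ cong (λ k → (q^ k · qbinom (width (suc n)) (suc j)) t) (exponent-suc n j) ⟩
  (q^ e · qbinom (suc (suc (width n))) (suc j)) t
    ≡⟨ q^-cong e (qbinom-double-step (width n) j) t ⟩
  (q^ e · (Q j ⊕ q^ suc w · Q j ⊕ q^ (suc w ∸ j) · previous Q j ⊕ q^ suc j · Q (suc j))) t
    ≡⟨ trans (q^-⊕ e _ _ t) (cong₂ _+_ (trans (q^-⊕ e _ _ t) (cong₂ _+_ (q^-⊕ e _ _ t) refl)) refl) ⟩
  (q^ e · Q j) t + (q^ e · q^ suc w · Q j) t + (q^ e · q^ (suc w ∸ j) · previous Q j) t
    + (q^ e · q^ suc j · Q (suc j)) t
    ≡⟨ cong₂ _+_ (cong₂ _+_ (cong (λ z → (q^ e · Q j) t + z)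
                                   (q^-exponents e (suc w) (suc w) e (Q j) (ℕₚ.+-comm e (suc w)) t))
                            (previous-term j j≤w+1))
                 (q^-exponents e (suc j) (suc n) (exponent n (suc j)) (Q (suc j)) (sym (exponent-up n j)) t) ⟩
  (jacobiBinomial n j ⊕ q^ suc w · jacobiBinomial n j
    ⊕ q^ suc n · previous (jacobiBinomial n) j ⊕ q^ suc n · jacobiBinomial n (suc j)) t
    ∎
  where
  open ≡-Reasoning
  e = exponent n j
  w = width n
  Q = qbinom w
  previous-term : ∀ j → j ≤ suc w →
    (q^ exponent n j · q^ (suc w ∸ j) · previous Q j) t ≡ (q^ suc n · previous (jacobiBinomial n) j) t
  previous-term zero    _ = trans (q^-zero (exponent n 0) (q^-zero (suc w) (λ _ → refl)) t)
                                  (sym (q^-zero (suc n) (λ _ → refl) t))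
  previous-term (suc i) i+1≤w+1 =
    q^-exponents (exponent n (suc i)) (w ∸ i) (suc n) (exponent n i) (Q i)
                 (sym (exponent-down n i (ℕₚ.≤-pred i+1≤w+1))) t

jacobiTerm-vanish : ∀ n i → suc (width n) ≤ i → jacobiTerm n i ≗ 0ˢ
jacobiTerm-vanish n i w<i t =
  trans (cong (sign (suc n ℕ.+ i) *_) (q^-zero (exponent n i) (qbinom-vanish (width n) i w<i) t))
        (ℤₚ.*-zeroʳ (sign (suc n ℕ.+ i)))

jacobiTerm-constant : ∀ n → jacobiTerm (suc n) 0 ≗ ⊖ (q^ suc n · jacobiTerm n 0)
jacobiTerm-constant n t = begin
  sign (suc (suc n) ℕ.+ 0) * (q^ tri (suc n) · 1ˢ) t     ≡⟨ cong (_* X) (ℤₚ.neg-involutive s) ⟩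
  s * X                                                  ≡⟨ sym (ℤₚ.neg-involutive _) ⟩
  - (- (s * X))                                          ≡⟨ cong -_ (ℤₚ.neg-distribˡ-* s X) ⟩
  - (- s * X)                               ≡⟨ cong (λ z → - (- s * z)) (sym (q^-+ (suc n) (tri n) 1ˢ t)) ⟩
  - (- s * (q^ suc n · q^ tri n · 1ˢ) t)    ≡⟨ cong -_ (sym (q^-• (suc n) (- s) (q^ tri n · 1ˢ) t)) ⟩
  - (q^ suc n · (- s • q^ tri n · 1ˢ)) t                 ≡⟨ cong -_ (q^-cong (suc n) binomial t) ⟩
  - (q^ suc n · jacobiTerm n 0) t                        ∎
  where
  open ≡-Reasoning
  s = sign (n ℕ.+ 0)
  X = (q^ tri (suc n) · 1ˢ) t
  binomial : - s • q^ tri n · 1ˢ ≗ jacobiTerm n 0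
  binomial k = cong (- s *_) (q^-cong (tri n) (λ k′ → sym (qbinom-zeroʳ (width n) k′)) k)

jacobiTerm-step : ∀ n j → j ≤ suc (width n) →
  jacobiTerm (suc n) (suc j) ≗ jacobiTerm n j ⊕ q^ (suc n ℕ.+ suc n) · jacobiTerm n j
                               ⊕ ⊖ (q^ suc n · previous (jacobiTerm n) j) ⊕ ⊖ (q^ suc n · jacobiTerm n (suc j))
jacobiTerm-step n j j≤w+1 t = begin
  sign (suc (suc n) ℕ.+ suc j) * jacobiBinomial (suc n) (suc j) t
    ≡⟨ cong₂ _*_ sign-shift (jacobiBinomial-step n j j≤w+1 t) ⟩
  s * (a + b + c + d)
    ≡⟨ distribute s a b c d ⟩
  s * a + s * b + - ((- s) * c) + - ((- s) * d)
    ≡⟨ cong₂ _+_ (cong₂ _+_ (cong (λ z → s * a + z) b-term) (cong -_ c-term)) (cong -_ d-term) ⟩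
  (jacobiTerm n j ⊕ q^ (suc n ℕ.+ suc n) · jacobiTerm n j
    ⊕ ⊖ (q^ suc n · previous (jacobiTerm n) j) ⊕ ⊖ (q^ suc n · jacobiTerm n (suc j))) t
    ∎
  where
  open ≡-Reasoning
  s = sign (suc n ℕ.+ j)
  a = jacobiBinomial n j t
  b = (q^ suc (width n) · jacobiBinomial n j) t
  c = (q^ suc n · previous (jacobiBinomial n) j) t
  d = (q^ suc n · jacobiBinomial n (suc j)) t
  sign-suc : ∀ j → sign (suc n ℕ.+ suc j) ≡ - sign (suc n ℕ.+ j)
  sign-suc j = cong (λ k → - sign k) (ℕₚ.+-suc n j)
  sign-shift : sign (suc (suc n) ℕ.+ suc j) ≡ s
  sign-shift = trans (ℤₚ.neg-involutive (sign (n ℕ.+ suc j))) (cong sign (ℕₚ.+-suc n j))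
  previous-jacobiTerm : ∀ j →
    previous (jacobiTerm n) j ≗ (- sign (suc n ℕ.+ j)) • previous (jacobiBinomial n) j
  previous-jacobiTerm zero    t = sym (ℤₚ.*-zeroʳ (- sign (suc n ℕ.+ 0)))
  previous-jacobiTerm (suc j) t =
    cong (_* jacobiBinomial n j t) (trans (sym (ℤₚ.neg-involutive _)) (cong -_ (sym (sign-suc j))))
  b-term : s * b ≡ (q^ (suc n ℕ.+ suc n) · jacobiTerm n j) t
  b-term = trans (sym (q^-• (suc (width n)) s (jacobiBinomial n j) t))
                 (cong (λ k → (q^ k · jacobiTerm n j) t) (cong suc (trans (width≡ n) (sym (ℕₚ.+-suc n n)))))
  c-term : (- s) * c ≡ (q^ suc n · previous (jacobiTerm n) j) t
  c-term = sym (trans (q^-cong (suc n) (previous-jacobiTerm j) t)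
                      (q^-• (suc n) (- s) (previous (jacobiBinomial n) j) t))
  d-term : (- s) * d ≡ (q^ suc n · jacobiTerm n (suc j)) t
  d-term = sym (trans (q^-• (suc n) (sign (suc n ℕ.+ suc j)) (jacobiBinomial n (suc j)) t)
                      (cong (_* d) (sign-suc j)))
  distribute : ∀ s a b c d → s * (a + b + c + d) ≡ s * a + s * b + - ((- s) * c) + - ((- s) * d)
  distribute = solve-∀

jacobiTerm-isQuadraticMultiple : ∀ n →
  IsQuadraticMultiple (suc n) (suc (width n)) (jacobiTerm n) (jacobiTerm (suc n))
jacobiTerm-isQuadraticMultiple n = record
  { vanish   = jacobiTerm-vanish n
  ; constant = jacobiTerm-constant n
  ; step     = jacobiTerm-step n
  }

-- The polynomial vanishes at z = 1 ...
∑-jacobiTerm : ∀ n → ∑ˢ (suc (width n)) (jacobiTerm n) ≗ 0ˢ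
∑-jacobiTerm zero    zero    = refl
∑-jacobiTerm zero    (suc t) = refl
∑-jacobiTerm (suc n) t =
  trans (∑-quadraticMultiple (jacobiTerm-isQuadraticMultiple n) t)
        (1-q^-zero (suc n) (1-q^-zero (suc n) (∑-jacobiTerm n)) t)

-- ... and its derivative there is ∏ⱼ₌₁ⁿ (1 - qʲ)².
moment-jacobiTerm : ∀ n → ∑ˢ (suc (width n)) (λ i → + i • jacobiTerm n i) ≗ euler n ⊗ euler n
moment-jacobiTerm zero    zero    = refl
moment-jacobiTerm zero    (suc t) = sym (⊗-identityˡ 1ˢ (suc t))
moment-jacobiTerm (suc n) t = begin
  ∑ˢ (suc (width (suc n))) (λ i → + i • jacobiTerm (suc n) i) t
    ≡⟨ moment-quadraticMultiple (jacobiTerm-isQuadraticMultiple n) (∑-jacobiTerm n) t ⟩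
  (1-q^ suc n · 1-q^ suc n · ∑ˢ (suc (width n)) (λ i → + i • jacobiTerm n i)) t
    ≡⟨ 1-q^²-cong (moment-jacobiTerm n) t ⟩
  (1-q^ suc n · 1-q^ suc n · (euler n ⊗ euler n)) t
    ≡⟨ sym (trans (1-q^-⊗ˡ (suc n) (euler n) (euler (suc n)) t)
                  (1-q^-cong (suc n) (1-q^-⊗ʳ (suc n) (euler n) (euler n)) t)) ⟩
  (euler (suc n) ⊗ euler (suc n)) t
    ∎
  where
  open ≡-Reasoning
  1-q^²-cong : ∀ {f g} → f ≗ g → 1-q^ suc n · 1-q^ suc n · f ≗ 1-q^ suc n · 1-q^ suc n · g
  1-q^²-cong eq = 1-q^-cong (suc n) (1-q^-cong (suc n) eq)

n≤tri : ∀ n → n ≤ tri n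
n≤tri zero    = z≤n
n≤tri (suc n) = ℕₚ.m≤m+n (suc n) (tri n)

exponent-below : ∀ {n i} → i ≤ n → exponent n i ≡ tri (n ∸ i)
exponent-below {n} {i} i≤n =
  cong triℤ (trans (ℤₚ.m-n≡m⊖n i (suc n))
                   (trans (ℤₚ.⊖-< (s≤s i≤n)) (cong (λ z → - + z) (ℕₚ.+-∸-assoc 1 i≤n))))

exponent-above : ∀ {n i} → n < i → exponent n i ≡ tri (i ∸ suc n)
exponent-above {n} {i} n<i = cong triℤ (trans (ℤₚ.m-n≡m⊖n i (suc n)) (ℤₚ.⊖-≥ n<i))

euler-⊗-qbinom-low : ∀ {n i} → i ≤ n → euler n ⊗ qbinom (width n) i ≡ 1ˢ mod-q^ suc i
euler-⊗-qbinom-low {n} {i} i≤n =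
  mod-resp-≗ (⊗-comm (qbinom (width n) i) (euler n)) (λ _ → refl)
    (mod-trans (⊗-mod (λ _ _ → refl) (mod-sym (stable⇒converges euler-stable i≤n)))
               (mod-weaken (s≤s i≤w∸i) (qbinom-⊗-euler (width n) i (ℕₚ.≤-trans i≤n n≤w))))
  where
  n≤w : n ≤ width n
  n≤w = ℕₚ.≤-trans (ℕₚ.m≤m+n n n) (ℕₚ.<⇒≤ (n+n<width n))
  i≤w∸i : i ≤ width n ∸ i
  i≤w∸i = ℕₚ.m+n≤o⇒m≤o∸n i (ℕₚ.≤-trans (ℕₚ.+-mono-≤ i≤n i≤n) (ℕₚ.<⇒≤ (n+n<width n)))

euler-⊗-qbinom-high : ∀ {n i} → n < i → i ≤ width n →
                      euler n ⊗ qbinom (width n) i ≡ 1ˢ mod-q^ suc (width n ∸ i)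
euler-⊗-qbinom-high {n} {i} n<i i≤w =
  mod-resp-≗ (⊗-comm (qbinom (width n) i) (euler n)) (λ _ → refl)
    (mod-trans (⊗-mod (λ _ _ → refl) (mod-weaken w∸i<i (stable⇒converges euler-stable (ℕₚ.<⇒≤ n<i))))
               (qbinom-⊗-euler (width n) i i≤w))
  where
  w∸i<i : suc (width n ∸ i) ≤ suc n
  w∸i<i = s≤s (ℕₚ.≤-trans (ℕₚ.∸-monoʳ-≤ (width n) n<i)
                          (ℕₚ.≤-reflexive (trans (cong (_∸ suc n) (width≡ n)) (ℕₚ.m+n∸m≡n n n))))

q^-euler-⊗-qbinom : ∀ n i → i ≤ width n →
  q^ exponent n i · (euler n ⊗ qbinom (width n) i) ≡ q^ exponent n i · 1ˢ mod-q^ suc n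
q^-euler-⊗-qbinom n i i≤w with ℕₚ.≤-<-connex i n
... | inj₁ i≤n = mod-weaken enough (q^-mod (exponent n i) (euler-⊗-qbinom-low i≤n))
  where
  enough : suc n ≤ exponent n i ℕ.+ suc i
  enough = begin
    suc n                       ≡⟨ cong suc (sym (ℕₚ.m∸n+n≡m i≤n)) ⟩
    suc (n ∸ i ℕ.+ i)           ≡⟨ sym (ℕₚ.+-suc (n ∸ i) i) ⟩
    n ∸ i ℕ.+ suc i             ≤⟨ ℕₚ.+-monoˡ-≤ (suc i) (n≤tri (n ∸ i)) ⟩
    tri (n ∸ i) ℕ.+ suc i       ≡⟨ cong (ℕ._+ suc i) (sym (exponent-below i≤n)) ⟩
    exponent n i ℕ.+ suc i      ∎
    where open ℕₚ.≤-Reasoning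
... | inj₂ n<i = mod-weaken enough (q^-mod (exponent n i) (euler-⊗-qbinom-high n<i i≤w))
  where
  d = i ∸ suc n
  i≡ : i ≡ suc n ℕ.+ d
  i≡ = sym (ℕₚ.m+[n∸m]≡n n<i)
  w∸i≡ : width n ∸ i ≡ n ∸ d
  w∸i≡ = trans (cong₂ _∸_ (width≡ n) i≡) (ℕₚ.[m+n]∸[m+o]≡n∸o n n d)
  d≤n : d ≤ n
  d≤n = ℕₚ.+-cancelˡ-≤ n d n (ℕₚ.≤-pred (begin
    suc n ℕ.+ d     ≡⟨ sym i≡ ⟩
    i               ≤⟨ i≤w ⟩
    width n         ≡⟨ width≡ n ⟩
    suc (n ℕ.+ n)   ∎))
    where open ℕₚ.≤-Reasoning
  enough : suc n ≤ exponent n i ℕ.+ suc (width n ∸ i)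
  enough = begin
    suc n                            ≡⟨ cong suc (sym (ℕₚ.m+[n∸m]≡n d≤n)) ⟩
    suc (d ℕ.+ (n ∸ d))              ≡⟨ sym (ℕₚ.+-suc d (n ∸ d)) ⟩
    d ℕ.+ suc (n ∸ d)                ≤⟨ ℕₚ.+-monoˡ-≤ (suc (n ∸ d)) (n≤tri d) ⟩
    tri d ℕ.+ suc (n ∸ d)
      ≡⟨ cong₂ (λ x y → x ℕ.+ suc y) (sym (exponent-above n<i)) (sym w∸i≡) ⟩
    exponent n i ℕ.+ suc (width n ∸ i) ∎
    where open ℕₚ.≤-Reasoning

∑ˢ-fold : ∀ n P → ∑ˢ (suc n ℕ.+ suc n) P ≗ ∑ˢ (suc n) (λ k → P (n ∸ k) ⊕ P (suc n ℕ.+ k))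
∑ˢ-fold n P t = begin
  ∑ (suc n ℕ.+ suc n) (λ i → P i t)
    ≡⟨ ∑-split (suc n) (suc n) (λ i → P i t) ⟩
  ∑[ k < suc n ] P k t + ∑[ k < suc n ] P (suc n ℕ.+ k) t
    ≡⟨ cong (_+ ∑[ k < suc n ] P (suc n ℕ.+ k) t) (∑-reverse (suc n) (λ i → P i t)) ⟩
  ∑[ k < suc n ] P (n ∸ k) t + ∑[ k < suc n ] P (suc n ℕ.+ k) t
    ≡⟨ sym (∑-distrib-+ (suc n) (λ k → P (n ∸ k) t) (λ k → P (suc n ℕ.+ k) t)) ⟩
  ∑[ k < suc n ] (P (n ∸ k) t + P (suc n ℕ.+ k) t)
    ∎
  where open ≡-Reasoning

jacobiCoeff : ℕ → ℤ
jacobiCoeff k = sign k * + suc (k ℕ.+ k)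

jacobiSum : ℕ → ℤSeries
jacobiSum n = ∑ˢ (suc n) (λ k → jacobiCoeff k • q^ tri k · 1ˢ)

-- the i-th term of the z-derivative at z = 1, with its Gaussian binomial replaced by 1
momentTerm : ℕ → ℕ → ℤSeries
momentTerm n i = + i • sign (suc n ℕ.+ i) • q^ exponent n i · 1ˢ

-- The terms i = n - k and i = n + 1 + k carry the same power q^(tri k).
momentTerm-pair : ∀ {n k} → k ≤ n →
  momentTerm n (n ∸ k) ⊕ momentTerm n (suc n ℕ.+ k) ≗ jacobiCoeff k • q^ tri k · 1ˢ
momentTerm-pair {n} {k} k≤n t = begin
  + j * (sign (suc n ℕ.+ j) * (q^ exponent n j · 1ˢ) t)
    + + (suc n ℕ.+ k) * (sign (suc n ℕ.+ (suc n ℕ.+ k)) * (q^ exponent n (suc n ℕ.+ k) · 1ˢ) t)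
    ≡⟨ cong₂ _+_ (cong (+ j *_) (cong₂ _*_ low-sign (cong (λ e → (q^ e · 1ˢ) t) low-exponent)))
                 (cong₂ _*_ high-factor (cong₂ _*_ high-sign (cong (λ e → (q^ e · 1ˢ) t) high-exponent))) ⟩
  + j * ((- sign k) * y) + (1ℤ + (+ j + + k) + + k) * (sign k * y)
    ≡⟨ collect (+ j) (+ k) (sign k) y ⟩
  (sign k * (1ℤ + + k + + k)) * y
    ≡⟨ cong (λ z → (sign k * z) * y) (sym (ℤₚ.pos-+ (suc k) k)) ⟩
  jacobiCoeff k * y
    ∎
  where
  open ≡-Reasoning
  j = n ∸ k
  y = (q^ tri k · 1ˢ) t
  j+k≡n : j ℕ.+ k ≡ n
  j+k≡n = ℕₚ.m∸n+n≡m k≤n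
  low-exponent : exponent n j ≡ tri k
  low-exponent = trans (exponent-below (ℕₚ.m∸n≤m n k)) (cong tri (ℕₚ.m∸[m∸n]≡n k≤n))
  high-exponent : exponent n (suc n ℕ.+ k) ≡ tri k
  high-exponent = trans (exponent-above (s≤s (ℕₚ.m≤m+n n k))) (cong tri (ℕₚ.m+n∸m≡n n k))
  low-sign : sign (suc n ℕ.+ j) ≡ - sign k
  low-sign = cong -_ (trans (cong (λ m → sign (m ℕ.+ j)) (sym j+k≡n))
                            (trans (cong sign (ℕₚ.+-comm (j ℕ.+ k) j)) (sign-cancel j k)))
  high-sign : sign (suc n ℕ.+ (suc n ℕ.+ k)) ≡ sign k
  high-sign = sign-cancel (suc n) k
  high-factor : + (suc n ℕ.+ k) ≡ 1ℤ + (+ j + + k) + + k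
  high-factor = trans (ℤₚ.pos-+ (suc n) k)
                      (cong (λ z → 1ℤ + z + + k) (trans (cong +_ (sym j+k≡n)) (ℤₚ.pos-+ j k)))
  collect : ∀ j k s y → j * ((- s) * y) + (1ℤ + (j + k) + k) * (s * y) ≡ (s * (1ℤ + k + k)) * y
  collect = solve-∀

euler³-moment : ∀ n → euler n ⊗ (euler n ⊗ euler n)
  ≗ ∑ˢ (suc (width n))
       (λ i → + i • sign (suc n ℕ.+ i) • q^ exponent n i · (euler n ⊗ qbinom (width n) i))
euler³-moment n t =
  trans (⊗-congʳ (euler n) (λ t′ → sym (moment-jacobiTerm n t′)) t)
        (trans (⊗-∑ʳ (suc (width n)) (euler n) (λ i → + i • jacobiTerm n i) t)
               (∑-cong (suc (width n)) (λ i _ → pull-in i)))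
  where
  pull-in : ∀ i → (euler n ⊗ (+ i • jacobiTerm n i)) t
                  ≡ + i * (sign (suc n ℕ.+ i) * (q^ exponent n i · (euler n ⊗ qbinom (width n) i)) t)
  pull-in i = trans (⊗-•ʳ (+ i) (euler n) (jacobiTerm n i) t)
                (cong (+ i *_) (trans (⊗-•ʳ (sign (suc n ℕ.+ i)) (euler n) (jacobiBinomial n i) t)
                                      (cong (sign (suc n ℕ.+ i) *_)
                                            (q^-⊗ʳ (exponent n i) (euler n) (qbinom (width n) i) t))))

jacobi-mod : ∀ n → euler n ⊗ (euler n ⊗ euler n) ≡ jacobiSum n mod-q^ suc n
jacobi-mod n =
  mod-resp-≗ (λ t → sym (euler³-moment n t)) paired
    (∑-mod (suc (width n)) (λ i i<w+1 →
       •-mod (+ i) (•-mod (sign (suc n ℕ.+ i)) (q^-euler-⊗-qbinom n i (ℕₚ.≤-pred i<w+1)))))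
  where
  paired : ∑ˢ (suc (width n)) (momentTerm n) ≗ jacobiSum n
  paired t = trans (cong (λ b → ∑ˢ b (momentTerm n) t) (cong suc (trans (width≡ n) (sym (ℕₚ.+-suc n n)))))
                   (trans (∑ˢ-fold n (momentTerm n) t)
                          (∑-cong (suc n) (λ k k<n+1 → momentTerm-pair (ℕₚ.≤-pred k<n+1) t)))

-- The generating function of p⁽³⁾

toℤSeries : Series → ℤSeries
toℤSeries f n = + f n

Σ≤-suc : ∀ n h → Σ≤ (suc n) h ≡ h 0 ℕ.+ Σ≤ n (h ∘ suc)
Σ≤-suc zero    h = refl
Σ≤-suc (suc n) h = trans (cong (ℕ._+ h (suc (suc n))) (Σ≤-suc n h)) (ℕₚ.+-assoc (h 0) _ _)

toℤSeries-⊛ : ∀ f g → toℤSeries (f ⊛ g) ≗ toℤSeries f ⊗ toℤSeries g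
toℤSeries-⊛ f g zero    = ℤₚ.pos-* (f 0) (g 0)
toℤSeries-⊛ f g (suc n) = begin
  + Σ≤ (suc n) (λ i → f i ℕ.* g (suc n ∸ i))    ≡⟨ cong +_ (Σ≤-suc n _) ⟩
  + (f 0 ℕ.* g (suc n) ℕ.+ ((f ∘ suc) ⊛ g) n)    ≡⟨ ℤₚ.pos-+ (f 0 ℕ.* g (suc n)) _ ⟩
  + (f 0 ℕ.* g (suc n)) + + ((f ∘ suc) ⊛ g) n
    ≡⟨ cong₂ _+_ (ℤₚ.pos-* (f 0) (g (suc n))) (toℤSeries-⊛ (f ∘ suc) g n) ⟩
  (toℤSeries f ⊗ toℤSeries g) (suc n)            ∎
  where open ≡-Reasoning

geometric : ℕ → ℤSeries
geometric N = toℤSeries (geomInv N)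

geometric-mod : ∀ N → geometric N ≡ 1ˢ mod-q^ suc N
geometric-mod N zero    _     = refl
geometric-mod N (suc t) t<N+1 = cong (λ x → + (if x ≡ᵇ 0 then 1 else 0)) (m<n⇒m%n≡m t<N+1)

geometric-unfold : ∀ N → geometric N ≗ 1ˢ ⊕ q^ suc N · geometric N
geometric-unfold N t with ℕₚ.<-≤-connex t (suc N)
... | inj₁ t<N+1 = trans (geometric-mod N t t<N+1)
                         (sym (trans (cong (λ z → 1ˢ t + z) (q^-below (suc N) (geometric N) t t<N+1))
                                     (ℤₚ.+-identityʳ _)))
... | inj₂ N+1≤t = subst (λ t′ → geometric N t′ ≡ (1ˢ ⊕ q^ suc N · geometric N) t′)
                         (ℕₚ.m+[n∸m]≡n N+1≤t) (periodic (t ∸ suc N))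
  where
  periodic : ∀ m → geometric N (suc N ℕ.+ m) ≡ (1ˢ ⊕ q^ suc N · geometric N) (suc N ℕ.+ m)
  periodic m =
    trans (cong (λ x → + (if x ≡ᵇ 0 then 1 else 0))
                (trans (cong (_% suc N) (ℕₚ.+-comm (suc N) m)) ([m+n]%n≡m%n m (suc N))))
          (sym (trans (ℤₚ.+-identityˡ _) (q^-at (suc N) (geometric N) m)))

1-q^-⊗-geometric : ∀ N → (1-q^ suc N · 1ˢ) ⊗ geometric N ≗ 1ˢ
1-q^-⊗-geometric N t = begin
  ((1-q^ suc N · 1ˢ) ⊗ G) t              ≡⟨ 1-q^-⊗ˡ (suc N) 1ˢ G t ⟩
  (1ˢ ⊗ G) t - (q^ suc N · (1ˢ ⊗ G)) t
    ≡⟨ cong₂ _-_ (⊗-identityˡ G t) (q^-cong (suc N) (⊗-identityˡ G) t) ⟩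
  G t - (q^ suc N · G) t                 ≡⟨ cong (_- (q^ suc N · G) t) (geometric-unfold N t) ⟩
  (1ˢ t + (q^ suc N · G) t) - (q^ suc N · G) t ≡⟨ cancel (1ˢ t) _ ⟩
  1ˢ t                                   ∎
  where
  open ≡-Reasoning
  G = geometric N
  cancel : ∀ a b → (a + b) - b ≡ a
  cancel = solve-∀

eulerInv³ : ℕ → ℤSeries
eulerInv³ N = toℤSeries (prodInv3 N)

eulerInv³-suc : ∀ N → eulerInv³ (suc N) ≗ eulerInv³ N ⊗ (geometric N ⊗ (geometric N ⊗ geometric N))
eulerInv³-suc N t =
  trans (toℤSeries-⊛ (prodInv3 N) _ t)
        (⊗-congʳ (eulerInv³ N) (λ t′ → trans (toℤSeries-⊛ (geomInv N) _ t′)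
                                             (⊗-congʳ (geometric N) (toℤSeries-⊛ (geomInv N) (geomInv N)) t′)) t)

ℤSeries-commutativeMonoid : CommutativeMonoid _ _
ℤSeries-commutativeMonoid = record
  { Carrier = ℤSeries ; _≈_ = _≗_ ; _∙_ = _⊗_ ; ε = 1ˢ
  ; isCommutativeMonoid = record
    { isMonoid = record
      { isSemigroup = record
        { isMagma = record
          { isEquivalence = record
            { refl = λ _ → refl ; sym = λ eq n → sym (eq n) ; trans = λ eq eq′ n → trans (eq n) (eq′ n) }
          ; ∙-cong = ⊗-cong }
        ; assoc = ⊗-assoc }
      ; identity = ⊗-identityˡ , ⊗-identityʳ }
    ; comm = ⊗-comm } }

euler³-⊗-eulerInv³ : ∀ N → euler N ⊗ (euler N ⊗ (euler N ⊗ eulerInv³ N)) ≗ 1ˢ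
euler³-⊗-eulerInv³ zero t =
  trans (⊗-identityˡ _ t) (trans (⊗-identityˡ _ t) (trans (⊗-identityˡ _ t) (base t)))
  where
  base : eulerInv³ 0 ≗ 1ˢ
  base zero    = refl
  base (suc t) = refl
-- Each new factor 1 - q^(N+1) of (q; q)³ cancels one of the three new geometric series.
euler³-⊗-eulerInv³ (suc N) =
  ≈-trans (⊗-cong E′ (⊗-cong E′ (⊗-cong E′ (eulerInv³-suc N))))
  (≈-trans (rearrange (euler N) (1-q^ suc N · 1ˢ) (eulerInv³ N) (geometric N))
  (≈-trans (⊗-cong (euler³-⊗-eulerInv³ N)
                   (⊗-cong (1-q^-⊗-geometric N) (⊗-cong (1-q^-⊗-geometric N) (1-q^-⊗-geometric N))))
           (λ t → trans (⊗-identityˡ _ t) (trans (⊗-identityˡ _ t) (⊗-identityˡ 1ˢ t)))))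
  where
  open CommutativeMonoid ℤSeries-commutativeMonoid using () renaming (trans to ≈-trans)
  open import Algebra.Solver.CommutativeMonoid ℤSeries-commutativeMonoid using (prove; var)
    renaming (_⊕_ to _∙_)
  import Data.Fin as Fin
  open import Data.Vec using ([]; _∷_)
  E′ : euler (suc N) ≗ euler N ⊗ (1-q^ suc N · 1ˢ)
  E′ = 1-q^-as-⊗ (suc N) (euler N)
  rearrange : ∀ e f p g →
    (e ⊗ f) ⊗ ((e ⊗ f) ⊗ ((e ⊗ f) ⊗ (p ⊗ (g ⊗ (g ⊗ g)))))
    ≗ (e ⊗ (e ⊗ (e ⊗ p))) ⊗ ((f ⊗ g) ⊗ ((f ⊗ g) ⊗ (f ⊗ g)))
  rearrange e f p g =
    prove 4 ((E ∙ F) ∙ ((E ∙ F) ∙ ((E ∙ F) ∙ (P ∙ (G ∙ (G ∙ G))))))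
            ((E ∙ (E ∙ (E ∙ P))) ∙ ((F ∙ G) ∙ ((F ∙ G) ∙ (F ∙ G))))
            (e ∷ f ∷ p ∷ g ∷ [])
    where
    E = var Fin.zero
    F = var (Fin.suc Fin.zero)
    P = var (Fin.suc (Fin.suc Fin.zero))
    G = var (Fin.suc (Fin.suc (Fin.suc Fin.zero)))

eulerInv³-stable : ∀ N → eulerInv³ (suc N) ≡ eulerInv³ N mod-q^ suc N
eulerInv³-stable N =
  mod-resp-≗ (λ t → sym (eulerInv³-suc N t)) (⊗-identityʳ (eulerInv³ N))
    (⊗-mod (λ _ _ → refl)
           (mod-resp-≗ (λ _ → refl) (λ t → trans (⊗-identityˡ _ t) (⊗-identityˡ 1ˢ t))
                       (⊗-mod G≡1 (⊗-mod G≡1 G≡1))))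
  where G≡1 = geometric-mod N

shifted : (ℕ → ℤ) → ℕ → ℕ → ℤ
shifted a n t = if t ≤ᵇ n then a (n ∸ t) else 0ℤ

p3ℤ : ℕ → ℤ
p3ℤ n = + p3 n

q^-eulerInv³-coefficient : ∀ n k → (q^ k · eulerInv³ n) n ≡ shifted p3ℤ n k
q^-eulerInv³-coefficient n k with k ≤ᵇ n in k≤ᵇn
... | true  = begin
  (q^ k · eulerInv³ n) n               ≡⟨ cong (q^ k · eulerInv³ n) (sym (ℕₚ.m+[n∸m]≡n k≤n)) ⟩
  (q^ k · eulerInv³ n) (k ℕ.+ (n ∸ k)) ≡⟨ q^-at k (eulerInv³ n) (n ∸ k) ⟩
  eulerInv³ n (n ∸ k)
    ≡⟨ sym (stable⇒converges eulerInv³-stable (ℕₚ.m∸n≤m n k) (n ∸ k) ℕₚ.≤-refl) ⟩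
  + p3 (n ∸ k)                         ∎
  where
  open ≡-Reasoning
  k≤n = ℕₚ.≤ᵇ⇒≤ k n (subst T (sym k≤ᵇn) _)
... | false = q^-below k (eulerInv³ n) n (ℕₚ.≰⇒> (λ k≤n → subst T k≤ᵇn (ℕₚ.≤⇒≤ᵇ k≤n)))

jacobiSum-⊗-eulerInv³ : ∀ n → ∑[ k < suc n ] (jacobiCoeff k * shifted p3ℤ n (tri k)) ≡ 1ˢ n
jacobiSum-⊗-eulerInv³ n = begin
  ∑[ k < suc n ] (jacobiCoeff k * shifted p3ℤ n (tri k))
    ≡⟨ ∑-cong (suc n) (λ k _ → sym (coefficient k)) ⟩
  ∑[ k < suc n ] ((jacobiCoeff k • q^ tri k · 1ˢ) ⊗ eulerInv³ n) n
    ≡⟨ sym (⊗-∑ˡ (suc n) (λ k → jacobiCoeff k • q^ tri k · 1ˢ) (eulerInv³ n) n) ⟩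
  (jacobiSum n ⊗ eulerInv³ n) n
    ≡⟨ sym (⊗-mod (jacobi-mod n) (λ _ _ → refl) n ℕₚ.≤-refl) ⟩
  ((euler n ⊗ (euler n ⊗ euler n)) ⊗ eulerInv³ n) n
    ≡⟨ ⊗-assoc (euler n) _ (eulerInv³ n) n ⟩
  (euler n ⊗ ((euler n ⊗ euler n) ⊗ eulerInv³ n)) n
    ≡⟨ ⊗-congʳ (euler n) (⊗-assoc (euler n) (euler n) (eulerInv³ n)) n ⟩
  (euler n ⊗ (euler n ⊗ (euler n ⊗ eulerInv³ n))) n
    ≡⟨ euler³-⊗-eulerInv³ n n ⟩
  1ˢ n
    ∎
  where
  open ≡-Reasoning
  coefficient : ∀ k →
    ((jacobiCoeff k • q^ tri k · 1ˢ) ⊗ eulerInv³ n) n ≡ jacobiCoeff k * shifted p3ℤ n (tri k)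
  coefficient k =
    trans (⊗-•ˡ (jacobiCoeff k) (q^ tri k · 1ˢ) (eulerInv³ n) n)
          (cong (jacobiCoeff k *_)
                (trans (q^-⊗ˡ (tri k) 1ˢ (eulerInv³ n) n)
                       (trans (q^-cong (tri k) (⊗-identityˡ (eulerInv³ n)) n)
                              (q^-eulerInv³-coefficient n (tri k)))))

partWeight : ℕ → ℤ
partWeight k = sign k * + (2 ℕ.* suc k ℕ.+ 1)

-- In jacobiSum-⊗-eulerInv³ (suc m) the term k = 0 is p⁽³⁾(m + 1) and the total is 0.
p3-recurrence : ∀ m →
  + p3 (suc m) ≡ ∑[ k < suc m ] (partWeight k * shifted p3ℤ (suc m) (tri (suc k)))
p3-recurrence m = begin
  + p3 n                ≡⟨ isolate (+ p3 n) S ⟩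
  (jacobiCoeff 0 * shifted p3ℤ n 0 + S) + - S
                        ≡⟨ cong (_+ - S) (jacobiSum-⊗-eulerInv³ n) ⟩
  0ℤ + - S              ≡⟨ ℤₚ.+-identityˡ _ ⟩
  - S                   ≡⟨ sym (∑-neg n (λ k → jacobiCoeff (suc k) * shifted p3ℤ n (tri (suc k)))) ⟩
  ∑[ k < n ] (- (jacobiCoeff (suc k) * shifted p3ℤ n (tri (suc k))))
                        ≡⟨ ∑-cong n (λ k _ → term k) ⟩
  ∑[ k < n ] (partWeight k * shifted p3ℤ n (tri (suc k)))
                        ∎
  where
  open ≡-Reasoning
  n = suc m
  S = ∑[ k < n ] (jacobiCoeff (suc k) * shifted p3ℤ n (tri (suc k)))
  isolate : ∀ p s → p ≡ ((1ℤ * + 1) * p + s) + - s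
  isolate = solve-∀
  odd : ∀ k → suc (suc k ℕ.+ suc k) ≡ 2 ℕ.* suc k ℕ.+ 1
  odd = ℕ-Solver.solve-∀
  negate : ∀ k → - jacobiCoeff (suc k) ≡ partWeight k
  negate k = trans (cong -_ (sym (ℤₚ.neg-distribˡ-* (sign k) _)))
                   (trans (ℤₚ.neg-involutive _) (cong (λ z → sign k * + z) (odd k)))
  term : ∀ k → - (jacobiCoeff (suc k) * shifted p3ℤ n (tri (suc k)))
               ≡ partWeight k * shifted p3ℤ n (tri (suc k))
  term k = trans (ℤₚ.neg-distribˡ-* (jacobiCoeff (suc k)) _)
                 (cong (_* shifted p3ℤ n (tri (suc k))) (negate k))

-- Weights of compositions

tri-<-mono : ∀ {a b} → a < b → tri a < tri b
tri-<-mono {a} {suc b} (s≤s a≤b) with ℕₚ.m≤n⇒m<n∨m≡n a≤b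
... | inj₂ refl = s≤s (ℕₚ.m≤n+m (tri a) a)
... | inj₁ a<b  = ℕₚ.<-≤-trans (tri-<-mono a<b) (ℕₚ.m≤n+m (tri b) (suc b))

tri-injective : ∀ {a b} → tri a ≡ tri b → a ≡ b
tri-injective {a} {b} eq with ℕₚ.<-cmp a b
... | tri< a<b _ _ = ⊥-elim (ℕₚ.<-irrefl eq (tri-<-mono a<b))
... | tri≈ _ a≡b _ = a≡b
... | tri> _ _ b<a = ⊥-elim (ℕₚ.<-irrefl (sym eq) (tri-<-mono b<a))

tri-even : ∀ m → tri (m ℕ.+ m) ≡ m ℕ.* (2 ℕ.* m ℕ.+ 1)
tri-even m = ℕₚ.*-cancelˡ-≡ _ _ 2 (trans (double-tri (m ℕ.+ m)) (expand m))
  where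
  double-tri : ∀ n → 2 ℕ.* tri n ≡ n ℕ.* suc n
  double-tri zero    = refl
  double-tri (suc n) = trans (ℕₚ.*-distribˡ-+ 2 (suc n) (tri n))
                             (trans (cong (2 ℕ.* suc n ℕ.+_) (double-tri n)) (step n))
    where
    step : ∀ n → 2 ℕ.* suc n ℕ.+ n ℕ.* suc n ≡ suc n ℕ.* suc (suc n)
    step = ℕ-Solver.solve-∀
  expand : ∀ m → (m ℕ.+ m) ℕ.* suc (m ℕ.+ m) ≡ 2 ℕ.* (m ℕ.* (2 ℕ.* m ℕ.+ 1))
  expand = ℕ-Solver.solve-∀

isHex-complete : ∀ m → T (isHex (m ℕ.* (2 ℕ.* m ℕ.+ 1)))
isHex-complete m = any⁺ _ (lose (∈-upTo⁺ (s≤s m≤x)) (ℕₚ.≡⇒≡ᵇ x x refl))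
  where
  x = m ℕ.* (2 ℕ.* m ℕ.+ 1)
  m≤x : m ≤ x
  m≤x = ℕₚ.≤-trans (ℕₚ.m≤m+n m m)
                   (ℕₚ.≤-trans (n≤tri (m ℕ.+ m)) (ℕₚ.≤-reflexive (tri-even m)))

isHex-sound : ∀ x → T (isHex x) → ∃[ m ] x ≡ m ℕ.* (2 ℕ.* m ℕ.+ 1)
isHex-sound x hex with find (any⁻ _ (upTo (suc x)) hex)
... | m , _ , x≡ᵇ = m , ℕₚ.≡ᵇ⇒≡ x _ x≡ᵇ

parity : ∀ k → (∃[ j ] k ≡ j ℕ.+ j) ⊎ (∃[ j ] k ≡ suc (j ℕ.+ j))
parity zero    = inj₁ (0 , refl)
parity (suc k) with parity k
... | inj₁ (j , refl) = inj₂ (j , refl)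
... | inj₂ (j , refl) = inj₁ (suc j , cong suc (sym (ℕₚ.+-suc j j)))

even≢odd : ∀ a b → a ℕ.+ a ≢ suc (b ℕ.+ b)
even≢odd (suc a) zero    eq = ℕₚ.0≢1+n (sym (trans (sym (ℕₚ.+-suc a a)) (ℕₚ.suc-injective eq)))
even≢odd (suc a) (suc b) eq =
  even≢odd a b (ℕₚ.suc-injective (trans (sym (ℕₚ.+-suc a a))
                                        (trans (ℕₚ.suc-injective eq) (cong suc (ℕₚ.+-suc b b)))))

indicator : Bool → ℕ
indicator b = if b then 1 else 0

indicator-true : ∀ {b} → T b → indicator b ≡ 1
indicator-true {true} _ = refl

indicator-false : ∀ {b} → ¬ T b → indicator b ≡ 0
indicator-false {false} _  = refl
indicator-false {true}  ¬t = ⊥-elim (¬t _)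

-- The part tri (k + 1) lies in {m(2m + 1)} exactly when k is odd.
signOfPart : ∀ k → (- 1ℤ) ^ℤ indicator (isHex (tri (suc k))) ≡ sign k
signOfPart k with parity k
... | inj₁ (j , refl) = trans (cong ((- 1ℤ) ^ℤ_) (indicator-false not-hex))
                              (sym (trans (sign-+ j j) (sign-square j)))
  where
  not-hex : ¬ T (isHex (tri (suc (j ℕ.+ j))))
  not-hex hex with isHex-sound _ hex
  ... | m , eq = even≢odd m j (sym (tri-injective (trans eq (sym (tri-even m)))))
... | inj₂ (j , refl) = trans (cong ((- 1ℤ) ^ℤ_) (indicator-true hex))
                              (sym (cong -_ (trans (sign-+ j j) (sign-square j))))
  where
  hex : T (isHex (tri (suc (suc (j ℕ.+ j)))))
  hex = subst (T ∘ isHex) (sym (trans (cong (tri ∘ suc) (sym (ℕₚ.+-suc j j))) (tri-even (suc j))))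
              (isHex-complete (suc j))

prodUpTo-∷ : ∀ N x c → prodUpTo N (x ∷ c) ≡ prodUpTo N (x ∷ []) ℕ.* prodUpTo N c
prodUpTo-∷ zero    x c = refl
prodUpTo-∷ (suc N) x c = begin
  prodUpTo N (x ∷ c) ℕ.* (b ^ (δ ℕ.+ mult i c))
    ≡⟨ cong₂ ℕ._*_ (prodUpTo-∷ N x c) (ℕₚ.^-distribˡ-+-* b δ (mult i c)) ⟩
  (prodUpTo N (x ∷ []) ℕ.* prodUpTo N c) ℕ.* (b ^ δ ℕ.* b ^ mult i c)
    ≡⟨ interchange (prodUpTo N (x ∷ [])) (prodUpTo N c) (b ^ δ) (b ^ mult i c) ⟩
  (prodUpTo N (x ∷ []) ℕ.* b ^ δ) ℕ.* (prodUpTo N c ℕ.* b ^ mult i c)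
    ≡⟨ cong (λ z → (prodUpTo N (x ∷ []) ℕ.* b ^ z) ℕ.* (prodUpTo N c ℕ.* b ^ mult i c))
            (sym (ℕₚ.+-identityʳ δ)) ⟩
  prodUpTo (suc N) (x ∷ []) ℕ.* prodUpTo (suc N) c
    ∎
  where
  open ≡-Reasoning
  i = tri (suc N)
  b = 2 ℕ.* suc N ℕ.+ 1
  δ = indicator (i ≡ᵇ x)
  interchange : ∀ p q r s → (p ℕ.* q) ℕ.* (r ℕ.* s) ≡ (p ℕ.* r) ℕ.* (q ℕ.* s)
  interchange = ℕ-Solver.solve-∀

mult-absent : ∀ {y} c → All (ℕ._< y) c → mult y c ≡ 0
mult-absent     []      _           = refl
mult-absent {y} (x ∷ c) (x<y ∷ c<y) =
  cong₂ ℕ._+_ (indicator-false (λ y≡ᵇx → ℕₚ.<-irrefl (sym (ℕₚ.≡ᵇ⇒≡ y x y≡ᵇx)) x<y))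
              (mult-absent c c<y)

prodUpTo-stable : ∀ S d c → All (_≤ S) c → prodUpTo (S ℕ.+ d) c ≡ prodUpTo S c
prodUpTo-stable S zero    c c≤S = cong (λ N → prodUpTo N c) (ℕₚ.+-identityʳ S)
prodUpTo-stable S (suc d) c c≤S = begin
  prodUpTo (S ℕ.+ suc d) c
    ≡⟨ cong (λ N → prodUpTo N c) (ℕₚ.+-suc S d) ⟩
  prodUpTo (S ℕ.+ d) c ℕ.* (2 ℕ.* suc (S ℕ.+ d) ℕ.+ 1) ^ mult (tri (suc (S ℕ.+ d))) c
    ≡⟨ cong (λ e → prodUpTo (S ℕ.+ d) c ℕ.* (2 ℕ.* suc (S ℕ.+ d) ℕ.+ 1) ^ e) (mult-absent c c<tri) ⟩
  prodUpTo (S ℕ.+ d) c ℕ.* 1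
    ≡⟨ trans (ℕₚ.*-identityʳ _) (prodUpTo-stable S d c c≤S) ⟩
  prodUpTo S c
    ∎
  where
  open ≡-Reasoning
  c<tri : All (ℕ._< tri (suc (S ℕ.+ d))) c
  c<tri = All.map (λ x≤S → ℕₚ.<-≤-trans (s≤s (ℕₚ.≤-trans x≤S (ℕₚ.m≤m+n S d)))
                                       (n≤tri (suc (S ℕ.+ d))))
                  c≤S

prodUpTo-singleton-early : ∀ N k → N ≤ k → prodUpTo N (tri (suc k) ∷ []) ≡ 1
prodUpTo-singleton-early zero    k _     = refl
prodUpTo-singleton-early (suc N) k N+1≤k =
  cong₂ ℕ._*_ (prodUpTo-singleton-early N k (ℕₚ.≤-trans (ℕₚ.n≤1+n N) N+1≤k))
              (cong (λ e → (2 ℕ.* suc N ℕ.+ 1) ^ (e ℕ.+ 0))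
                    (indicator-false (λ eq → ℕₚ.<-irrefl (ℕₚ.≡ᵇ⇒≡ _ _ eq) (tri-<-mono (s≤s N+1≤k)))))

prodUpTo-singleton : ∀ k d → prodUpTo (suc k ℕ.+ d) (tri (suc k) ∷ []) ≡ 2 ℕ.* suc k ℕ.+ 1
prodUpTo-singleton k zero = begin
  prodUpTo (suc k ℕ.+ 0) (x ∷ [])   ≡⟨ cong (λ N → prodUpTo N (x ∷ [])) (ℕₚ.+-identityʳ (suc k)) ⟩
  prodUpTo k (tri (suc k) ∷ []) ℕ.* (2 ℕ.* suc k ℕ.+ 1) ^ (indicator (tri (suc k) ≡ᵇ tri (suc k)) ℕ.+ 0)
    ≡⟨ cong₂ (λ p e → p ℕ.* (2 ℕ.* suc k ℕ.+ 1) ^ (e ℕ.+ 0))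
             (prodUpTo-singleton-early k k ℕₚ.≤-refl) (indicator-true (ℕₚ.≡⇒≡ᵇ x x refl)) ⟩
  1 ℕ.* ((2 ℕ.* suc k ℕ.+ 1) ℕ.* 1)           ≡⟨ trans (ℕₚ.*-identityˡ _) (ℕₚ.*-identityʳ _) ⟩
  2 ℕ.* suc k ℕ.+ 1                            ∎
  where
  open ≡-Reasoning
  x = tri (suc k)
prodUpTo-singleton k (suc d) = begin
  prodUpTo (suc k ℕ.+ suc d) (tri (suc k) ∷ [])
    ≡⟨ cong (λ N → prodUpTo N (tri (suc k) ∷ [])) (ℕₚ.+-suc (suc k) d) ⟩
  prodUpTo (suc k ℕ.+ d) (tri (suc k) ∷ []) ℕ.* (2 ℕ.* suc (suc k ℕ.+ d) ℕ.+ 1) ^ (δ ℕ.+ 0)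
    ≡⟨ cong₂ (λ p e → p ℕ.* (2 ℕ.* suc (suc k ℕ.+ d) ℕ.+ 1) ^ (e ℕ.+ 0))
             (prodUpTo-singleton k d) δ≡0 ⟩
  (2 ℕ.* suc k ℕ.+ 1) ℕ.* 1
    ≡⟨ ℕₚ.*-identityʳ _ ⟩
  2 ℕ.* suc k ℕ.+ 1
    ∎
  where
  open ≡-Reasoning
  δ = indicator (tri (suc (suc k ℕ.+ d)) ≡ᵇ tri (suc k))
  δ≡0 : δ ≡ 0
  δ≡0 = indicator-false
          (λ eq → ℕₚ.<-irrefl (sym (ℕₚ.≡ᵇ⇒≡ _ _ eq)) (tri-<-mono (s≤s (s≤s (ℕₚ.m≤m+n k d)))))

parts≤sum : ∀ c → All (_≤ sum c) c
parts≤sum []      = []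
parts≤sum (x ∷ c) =
  ℕₚ.m≤m+n x (sum c) ∷ All.map (λ y≤ → ℕₚ.≤-trans y≤ (ℕₚ.m≤n+m (sum c) x)) (parts≤sum c)

weight-∷ : ∀ k c → weight (tri (suc k) ∷ c) ≡ partWeight k * weight c
weight-∷ k c = begin
  (- 1ℤ) ^ℤ (indicator (isHex x) ℕ.+ ℓ⁺ c) * + prodUpTo (x ℕ.+ sum c) (x ∷ c)
    ≡⟨ cong₂ _*_ (ℤₚ.^-distribˡ-+-* (- 1ℤ) (indicator (isHex x)) (ℓ⁺ c))
                 (cong +_ (trans (prodUpTo-∷ (x ℕ.+ sum c) x c) (cong₂ ℕ._*_ head-factor tail-factor))) ⟩
  ((- 1ℤ) ^ℤ indicator (isHex x) * s) * + ((2 ℕ.* suc k ℕ.+ 1) ℕ.* weightProd c)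
    ≡⟨ cong₂ _*_ (cong (_* s) (signOfPart k)) (ℤₚ.pos-* (2 ℕ.* suc k ℕ.+ 1) (weightProd c)) ⟩
  (sign k * s) * (+ (2 ℕ.* suc k ℕ.+ 1) * + weightProd c)
    ≡⟨ interchange (sign k) s _ _ ⟩
  partWeight k * weight c
    ∎
  where
  open ≡-Reasoning
  x = tri (suc k)
  s = (- 1ℤ) ^ℤ ℓ⁺ c
  head-factor : prodUpTo (x ℕ.+ sum c) (x ∷ []) ≡ 2 ℕ.* suc k ℕ.+ 1
  head-factor = trans (cong (λ N → prodUpTo N (x ∷ [])) (ℕₚ.+-assoc (suc k) (tri k) (sum c)))
                      (prodUpTo-singleton k (tri k ℕ.+ sum c))
  tail-factor : prodUpTo (x ℕ.+ sum c) c ≡ weightProd c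
  tail-factor = trans (cong (λ N → prodUpTo N c) (ℕₚ.+-comm x (sum c)))
                      (prodUpTo-stable (sum c) x c (parts≤sum c))
  interchange : ∀ a b c d → (a * b) * (c * d) ≡ (a * c) * (b * d)
  interchange = solve-∀

-- Enumerating compositions

totalWeight : List (List ℕ) → ℤ
totalWeight L = sumℤ (map weight L)

totalWeight-++ : ∀ xs ys → totalWeight (xs ++ ys) ≡ totalWeight xs + totalWeight ys
totalWeight-++ []       ys = sym (ℤₚ.+-identityˡ _)
totalWeight-++ (c ∷ xs) ys =
  trans (cong (λ z → weight c + z) (totalWeight-++ xs ys)) (sym (ℤₚ.+-assoc (weight c) _ _))

totalWeight-map-∷ : ∀ k cs → totalWeight (map (tri (suc k) ∷_) cs) ≡ partWeight k * totalWeight cs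
totalWeight-map-∷ k []       = sym (ℤₚ.*-zeroʳ (partWeight k))
totalWeight-map-∷ k (c ∷ cs) =
  trans (cong₂ _+_ (weight-∷ k c) (totalWeight-map-∷ k cs))
        (sym (ℤₚ.*-distribˡ-+ (partWeight k) (weight c) _))

withFirstPart : (ℕ → List (List ℕ)) → ℕ → ℕ → List (List ℕ)
withFirstPart R n k = if tri (suc k) ≤ᵇ n then map (tri (suc k) ∷_) (R (n ∸ tri (suc k))) else []

withFirstParts : (ℕ → List (List ℕ)) → ℕ → List ℕ → List (List ℕ)
withFirstParts R n []       = []
withFirstParts R n (k ∷ ks) = withFirstPart R n k ++ withFirstParts R n ks

-- compositions f n lists the compositions of n with parts in P₃, but only when n < f.
compositions : ℕ → ℕ → List (List ℕ)
compositions zero    n       = []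
compositions (suc f) zero    = [] ∷ []
compositions (suc f) (suc m) = withFirstParts (compositions f) (suc m) (upTo (suc m))

totalWeight-withFirstPart : ∀ R n k →
  totalWeight (withFirstPart R n k) ≡ partWeight k * shifted (totalWeight ∘ R) n (tri (suc k))
totalWeight-withFirstPart R n k with tri (suc k) ≤ᵇ n
... | true  = totalWeight-map-∷ k (R (n ∸ tri (suc k)))
... | false = sym (ℤₚ.*-zeroʳ (partWeight k))

totalWeight-withFirstParts : ∀ R n f N →
  totalWeight (withFirstParts R n (applyUpTo f N))
  ≡ ∑[ i < N ] (partWeight (f i) * shifted (totalWeight ∘ R) n (tri (suc (f i))))
totalWeight-withFirstParts R n f zero    = refl
totalWeight-withFirstParts R n f (suc N) =
  trans (totalWeight-++ (withFirstPart R n (f 0)) _)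
        (cong₂ _+_ (totalWeight-withFirstPart R n (f 0)) (totalWeight-withFirstParts R n (f ∘ suc) N))

shifted-cong : ∀ {a b n} t → (∀ m → m < n → a m ≡ b m) → shifted a n (suc t) ≡ shifted b n (suc t)
shifted-cong {n = zero}  t eq = refl
shifted-cong {n = suc n} t eq with t ℕ.<ᵇ suc n
... | true  = eq (n ∸ t) (s≤s (ℕₚ.m∸n≤m n t))
... | false = refl

totalWeight-compositions : ∀ f n → n < f → totalWeight (compositions f n) ≡ p3ℤ n
totalWeight-compositions (suc f) zero    _         = refl
totalWeight-compositions (suc f) (suc m) (s≤s m<f) =
  trans (totalWeight-withFirstParts (compositions f) (suc m) id (suc m))
        (trans (∑-cong (suc m) (λ k _ → cong (partWeight k *_) (shifted-cong (k ℕ.+ tri k) IH)))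
               (sym (p3-recurrence m)))
  where
  IH : ∀ n → n < suc m → totalWeight (compositions f n) ≡ p3ℤ n
  IH n n<m+1 = totalWeight-compositions f n (ℕₚ.<-≤-trans n<m+1 m<f)

SplitsAt : (ℕ → List (List ℕ)) → ℕ → ℕ → List ℕ → Set
SplitsAt R n k c = tri (suc k) ≤ n × ∃[ c′ ] c ≡ tri (suc k) ∷ c′ × c′ ∈ R (n ∸ tri (suc k))

∈-withFirstPart⁻ : ∀ R n k {c} → c ∈ withFirstPart R n k → SplitsAt R n k c
∈-withFirstPart⁻ R n k c∈ with tri (suc k) ≤ᵇ n in ≤ᵇ-true
... | true with ∈-map⁻ (tri (suc k) ∷_) c∈
...   | c′ , c′∈ , c≡ = ℕₚ.≤ᵇ⇒≤ _ n (subst T (sym ≤ᵇ-true) _) , c′ , c≡ , c′∈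

∈-withFirstParts⁻ : ∀ R n ks {c} → c ∈ withFirstParts R n ks → ∃[ k ] k ∈ ks × SplitsAt R n k c
∈-withFirstParts⁻ R n (k ∷ ks) c∈ with ∈-++⁻ (withFirstPart R n k) c∈
... | inj₁ c∈k  = k , here refl , ∈-withFirstPart⁻ R n k c∈k
... | inj₂ c∈ks with ∈-withFirstParts⁻ R n ks c∈ks
...   | k′ , k′∈ , split = k′ , there k′∈ , split

∈-withFirstPart⁺ : ∀ R n k {c′} → tri (suc k) ≤ n → c′ ∈ R (n ∸ tri (suc k)) →
                   tri (suc k) ∷ c′ ∈ withFirstPart R n k
∈-withFirstPart⁺ R n k t≤n c′∈ with tri (suc k) ≤ᵇ n in ≤ᵇ-false
... | true  = ∈-map⁺ (tri (suc k) ∷_) c′∈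
... | false = ⊥-elim (subst T ≤ᵇ-false (ℕₚ.≤⇒≤ᵇ t≤n))

∈-withFirstParts⁺ : ∀ R n {ks k c′} → k ∈ ks → tri (suc k) ≤ n → c′ ∈ R (n ∸ tri (suc k)) →
                    tri (suc k) ∷ c′ ∈ withFirstParts R n ks
∈-withFirstParts⁺ R n {k ∷ _}  (here refl) t≤n c′∈ = ∈-++⁺ˡ (∈-withFirstPart⁺ R n k t≤n c′∈)
∈-withFirstParts⁺ R n {k′ ∷ _} (there k∈)  t≤n c′∈ =
  ∈-++⁺ʳ (withFirstPart R n k′) (∈-withFirstParts⁺ R n k∈ t≤n c′∈)

compositions-sound : ∀ f n {c} → c ∈ compositions f n → All InP3 c × sum c ≡ n
compositions-sound (suc f) zero    (here refl) = [] , refl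
compositions-sound (suc f) (suc m) c∈ with ∈-withFirstParts⁻ (compositions f) (suc m) (upTo (suc m)) c∈
... | k , _ , t≤n , c′ , refl , c′∈ with compositions-sound f (suc m ∸ tri (suc k)) c′∈
...   | c′∈P₃ , sum-c′ =
  (k , refl) ∷ c′∈P₃ , trans (cong (tri (suc k) ℕ.+_) sum-c′) (ℕₚ.m+[n∸m]≡n t≤n)

compositions-complete : ∀ f n {c} → n < f → All InP3 c → sum c ≡ n → c ∈ compositions f n
compositions-complete (suc f) zero    {[]}    _         _                  _     = here refl
compositions-complete (suc f) zero    {x ∷ c} _         ((k , refl) ∷ _)   ()
compositions-complete (suc f) (suc m) {x ∷ c} (s≤s m<f) ((k , refl) ∷ c∈P₃) sum-c =
  ∈-withFirstParts⁺ (compositions f) (suc m) (∈-upTo⁺ k<m+1) t≤n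
    (compositions-complete f (suc m ∸ t) rest<f c∈P₃ sum-rest)
  where
  t = tri (suc k)
  t≤n : t ≤ suc m
  t≤n = subst (t ≤_) sum-c (ℕₚ.m≤m+n t (sum c))
  k<m+1 : k < suc m
  k<m+1 = ℕₚ.≤-trans (n≤tri (suc k)) t≤n
  rest<f : suc m ∸ t < f
  rest<f = ℕₚ.≤-<-trans (ℕₚ.m∸n≤m m (k ℕ.+ tri k)) m<f
  sum-rest : sum c ≡ suc m ∸ t
  sum-rest = sym (trans (cong (_∸ t) (sym sum-c)) (ℕₚ.m+n∸m≡n t (sum c)))

compositions-unique : ∀ f n → Unique (compositions f n)
compositions-unique zero    n       = []
compositions-unique (suc f) zero    = [] ∷ []
compositions-unique (suc f) (suc m) = unique-withFirstParts (upTo (suc m)) (Unique.upTo⁺ (suc m))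
  where
  R = compositions f
  unique-withFirstPart : ∀ k → Unique (withFirstPart R (suc m) k)
  unique-withFirstPart k with tri (suc k) ≤ᵇ suc m
  ... | true  = Unique.map⁺ ∷-injectiveʳ (compositions-unique f (suc m ∸ tri (suc k)))
  ... | false = []
  unique-withFirstParts : ∀ ks → Unique ks → Unique (withFirstParts R (suc m) ks)
  unique-withFirstParts []       _            = []
  unique-withFirstParts (k ∷ ks) (k∉ks ∷ uks) =
    Unique.++⁺ (unique-withFirstPart k) (unique-withFirstParts ks uks) disjoint
    where
    disjoint : Disjoint (withFirstPart R (suc m) k) (withFirstParts R (suc m) ks)
    disjoint {c} (c∈k , c∈ks) with ∈-withFirstPart⁻ R (suc m) k c∈k | ∈-withFirstParts⁻ R (suc m) ks c∈ks
    ... | _ , _ , c≡ , _ | k′ , k′∈ks , _ , _ , c≡′ , _ =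
      All.lookup k∉ks k′∈ks (ℕₚ.suc-injective (tri-injective (∷-injectiveˡ (trans (sym c≡) c≡′))))

sumℤ-↭ : ∀ {xs ys} → xs ↭ ys → sumℤ xs ≡ sumℤ ys
sumℤ-↭ xs↭ys =
  PermSetoid.foldr-commMonoid (setoid ℤ) ℤₚ.+-0-isCommutativeMonoid (↭⇒↭ₛ′ isEquivalence xs↭ys)

mainTheorem9 : (n : ℕ) (L : List (List ℕ)) → Unique L →
    ((c : List ℕ) → (c ∈ L) ⇔ (All InP3 c × sum c ≡ n)) →
    + p3 n ≡ sumℤ (map weight L)
mainTheorem9 n L unique-L L-spec = begin
  + p3 n                                  ≡⟨ sym (totalWeight-compositions (suc n) n ℕₚ.≤-refl) ⟩
  totalWeight (compositions (suc n) n)    ≡⟨ sumℤ-↭ (Perm.map⁺ weight (↭-sym L↭compositions)) ⟩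
  sumℤ (map weight L)                     ∎
  where
  open ≡-Reasoning
  L↭compositions : L ↭ compositions (suc n) n
  L↭compositions = ∼bag⇒↭ (unique∧set⇒bag unique-L (compositions-unique (suc n) n) (λ {c} → mk⇔
    (λ c∈L → let (c∈P₃ , sum-c) = Equivalence.to (L-spec c) c∈L
             in compositions-complete (suc n) n ℕₚ.≤-refl c∈P₃ sum-c)
    (λ c∈C → Equivalence.from (L-spec c) (compositions-sound (suc n) n c∈C))))
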